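{- Let $q=(q_1,\ldots,q_n)$ be a weakly increasing sequence of positive integers and $\Delta_{(1,q)}:=\operatorname{conv}\{e_1,\ldots,e_n,-\sum_{i=1}^n q_ie_i\}\subset\mathbb{R}^n$. (1) If $\Delta_{(1,q)}$ is reflexive and has the integer decomposition property, then for all $j=1,\ldots,n$, \[ \frac{1}{q_j}+\sum_{i\neq j}\left\{\frac{q_i}{q_j}\right\}=1 . \] (2) If $q$ satisfies these equations for all $j=1,\ldots,n$, then $\Delta_{(1,q)}$ is reflexive. (3) These equations do not suffice for the integer decomposition property: for $q=(2,2,15,20,20)$ the equations hold for all $j$, but $\Delta_{(1,q)}$ does not have the integer decomposition property.
   Context: $e_i$ is the $i$-th standard basis vector; $\{x\}$ denotes the fractional part of $x$; sums $\sum_{i\ne j}$ range over $1\le i\le n$, $i\ne j$. A lattice polytope $P$ containing $0$ in its interior is reflexive if its polar $\{y: x^Ty\le 1\ \forall x\in P\}$ is a lattice polytope; for simplices $\Delta_{(1,q)}$ this is equivalent to $q_j$ dividing $1+\sum_{i\ne j}q_i$ for every $j$. A lattice polytope $P\subset\mathbb{R}^n$ has the integer decomposition property if for every positive integer $m$ and every $w\in mP\cap\mathbb{Z}^n$ there exist $x_1,\ldots,x_m\in P\cap\mathbb{Z}^n$ with $w=x_1+\cdots+x_m$.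
   Formalization: Stated over ℚ^n in place of ℝ^n: the points of the convex hulls, dilates, polars and neighbourhoods of 0 used for reflexivity and the integer decomposition property have rational coordinates, and convex-combination coefficients are rational. -}

module Defs where

open import Data.Nat as ℕ using (ℕ; zero; suc)
open import Data.Integer as ℤ using (ℤ; +_)
open import Data.Rational as ℚ using (ℚ; 0ℚ; 1ℚ; floor)
open import Data.Fin as Fin using (Fin; zero; suc)
open import Data.Product using (Σ; ∃; _×_; _,_)
open import Data.Bool using (if_then_else_)
open import Relation.Binary.PropositionalEquality using (_≡_)
open import Relation.Nullary.Decidable using (does)
open import Function.Bundles using (_⇔_)

QPoint : ℕ → Set
QPoint n = Fin n → ℚ

ZPoint : ℕ → Set
ZPoint n = Fin n → ℤ

embed : ∀ {n} → ZPoint n → QPoint n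
embed w i = w i ℚ./ 1

sumℚ : ∀ {k} → (Fin k → ℚ) → ℚ
sumℚ {zero} f = 0ℚ
sumℚ {suc k} f = f zero ℚ.+ sumℚ (λ t → f (suc t))

sumℤ : ∀ {k} → (Fin k → ℤ) → ℤ
sumℤ {zero} f = + 0
sumℤ {suc k} f = f zero ℤ.+ sumℤ (λ t → f (suc t))

dot : ∀ {n} → QPoint n → QPoint n → ℚ
dot x y = sumℚ (λ i → x i ℚ.* y i)

sumExcept : ∀ {n} → Fin n → (Fin n → ℚ) → ℚ
sumExcept j f = sumℚ (λ i → if does (i Fin.≟ j) then 0ℚ else f i)

InConvHull : ∀ {k n} → (Fin k → QPoint n) → QPoint n → Set
InConvHull {k} V x =
  Σ (Fin k → ℚ) λ c →
    (∀ t → 0ℚ ℚ.≤ c t) × (sumℚ c ≡ 1ℚ) × (∀ i → x i ≡ sumℚ (λ t → c t ℚ.* V t i))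

InDilate : ∀ {k n} → ℕ → (Fin k → QPoint n) → QPoint n → Set
InDilate m V x = Σ _ λ y → InConvHull V y × (∀ i → x i ≡ (+ m ℚ./ 1) ℚ.* y i)

IsLatticePolytope : ∀ {n} → (QPoint n → Set) → Set
IsLatticePolytope {n} S =
  Σ ℕ λ k → Σ (Fin k → ZPoint n) λ V → ∀ y → S y ⇔ InConvHull (λ t → embed (V t)) y

Polar : ∀ {n} → (QPoint n → Set) → QPoint n → Set
Polar S y = ∀ x → S x → dot x y ℚ.≤ 1ℚ

ZeroInInterior : ∀ {n} → (QPoint n → Set) → Set
ZeroInInterior S = Σ ℚ λ ε → (0ℚ ℚ.< ε) × (∀ y → (∀ i → ℚ.∣ y i ∣ ℚ.≤ ε) → S y)

Reflexive : ∀ {k n} → (Fin k → ZPoint n) → Set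
Reflexive V =
  IsLatticePolytope P × ZeroInInterior P × IsLatticePolytope (Polar P)
  where P = InConvHull (λ t → embed (V t))

IDP : ∀ {k n} → (Fin k → ZPoint n) → Set
IDP {k} {n} V =
  ∀ (m : ℕ) → 0 ℕ.< m → (w : ZPoint n) → InDilate m (λ t → embed (V t)) (embed w) →
    Σ (Fin m → ZPoint n) λ xs →
      (∀ t → InConvHull (λ s → embed (V s)) (embed (xs t))) ×
      (∀ i → w i ≡ sumℤ (λ t → xs t i))

unit : ∀ {n} → Fin n → ZPoint n
unit j i = if does (i Fin.≟ j) then + 1 else + 0

Δvert : ∀ {n} → (Fin n → ℕ) → Fin (suc n) → ZPoint n
Δvert q zero i = ℤ.- (+ q i)
Δvert q (suc j) = unit j

WeaklyIncreasing : ∀ {n} → (Fin n → ℕ) → Set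
WeaklyIncreasing q = ∀ i j → i Fin.≤ j → q i ℕ.≤ q j

Positive : ∀ {n} → (Fin n → ℕ) → Set
Positive q = ∀ i → 0 ℕ.< q i

-- a / b as a rational (b = 0 is never used: q is positive)
ratio : ℕ → ℕ → ℚ
ratio a zero = 0ℚ
ratio a (suc b) = (+ a) ℚ./ suc b

frac : ℚ → ℚ
frac x = x ℚ.- (floor x ℚ./ 1)

Eqn : ∀ {n} → (Fin n → ℕ) → Fin n → Set
Eqn q j = ratio 1 (q j) ℚ.+ sumExcept j (λ i → frac (ratio (q i) (q j))) ≡ 1ℚ

qEx : Fin 5 → ℕ
qEx zero = 2
qEx (suc zero) = 2
qEx (suc (suc zero)) = 15
qEx (suc (suc (suc zero))) = 20
qEx (suc (suc (suc (suc zero)))) = 20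

module Submission where

-- Write N = 1 + Σ q_i.  A point x lies in Δ with barycentric weights
-- c_0 = (1 - Σ x)/N on the vertex -q and c_i = x_i + c_0 q_i on e_i; hence a
-- lattice point x of Δ satisfies a(x) := 1 - Σ x ≥ 0 and N x_i + a(x) q_i ≥ 0.
-- Put r_i = q_i - q_j ⌊q_i/q_j⌋ ∈ [0, q_j) and R_j = Σ_{i≠j} r_i.  Multiplying
-- by q_j, equation (j) reads 1 + R_j = q_j, and N = 1 + R_j + q_j Σ_i ⌊q_i/q_j⌋.
--
-- (1) If Δ is reflexive, the polar vertex u = 1 - (N/q_j) e_j dual to the
--     facet opposite e_j is a convex combination of integer points of the
--     polar, which forces N = q_j h.  Then 1 + R_j = q_j k with
--     k ≥ 1; if k ≥ 2 the point w = -⌊q/q_j⌋ lies in kΔ, and every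
--     decomposition of w into k lattice points of Δ is impossible.
-- (2) If every equation holds, N = q_j D_j and the polar is the lattice simplex
--     conv{(1,…,1), 1 - D_j e_j}; 0 is interior since Δ contains a small box.
-- (3) For q = (2,2,15,20,20) the equations are checked by computation, and
--     w = (-1,-1,-8,-10,-10) ∈ 2Δ is not a sum of two lattice points of Δ.
--
-- The three parts follow.

open import Defs
open import Data.Nat as ℕ using (ℕ; zero; suc)
import Data.Nat.Properties as ℕP
open import Data.Integer as ℤ using (ℤ; +_; -[1+_])
import Data.Integer.Properties as ℤP
import Data.Integer.DivMod as ℤD
open import Data.Integer.Tactic.RingSolver as ℤSolver using ()
open import Data.Rational as Q using (ℚ; 0ℚ; 1ℚ)
import Data.Rational.Properties as QP
open import Data.Rational.Solver using (module +-*-Solver)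
import Data.Rational.Unnormalised as U
import Data.Rational.Unnormalised.Properties as UP
open import Data.Fin as Fin using (Fin; zero; suc)
open import Data.Product using (Σ; _×_; _,_; proj₁; proj₂)
open import Data.Sum using (_⊎_; inj₁; inj₂)
open import Data.Bool using (true; false; if_then_else_)
open import Data.List using (_∷_; [])
open import Data.Empty using (⊥; ⊥-elim)
open import Relation.Binary.PropositionalEquality
open import Relation.Binary.Definitions using (tri<; tri≈; tri>)
open import Relation.Nullary using (¬_; Dec; yes; no)
open import Relation.Nullary.Decidable using (does; True; toWitness)
open import Function.Bundles using (Equivalence; mk⇔)
open import Algebra.Bundles using (CommutativeRing)
import Algebra.Properties.Semiring.Sum as SemiringSum

ι : ℤ → ℚ
ι z = z Q./ 1

toℚᵘ-ι : ∀ z → Q.toℚᵘ (ι z) U.≃ U.mkℚᵘ z 0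
toℚᵘ-ι z = QP.toℚᵘ-fromℚᵘ (U.mkℚᵘ z 0)

ι-homo-+ : ∀ a b → ι (a ℤ.+ b) ≡ ι a Q.+ ι b
ι-homo-+ a b = QP.toℚᵘ-injective (UP.≃-trans (toℚᵘ-ι (a ℤ.+ b))
  (UP.≃-trans (U.*≡* cross)
  (UP.≃-sym (UP.≃-trans (QP.toℚᵘ-homo-+ (ι a) (ι b)) (UP.+-cong (toℚᵘ-ι a) (toℚᵘ-ι b))))))
  where
  cross : (a ℤ.+ b) ℤ.* + 1 ≡ (a ℤ.* + 1 ℤ.+ b ℤ.* + 1) ℤ.* + 1
  cross = ℤSolver.solve (a ∷ b ∷ [])

ι-homo-* : ∀ a b → ι (a ℤ.* b) ≡ ι a Q.* ι b
ι-homo-* a b = QP.toℚᵘ-injective (UP.≃-trans (toℚᵘ-ι (a ℤ.* b))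
  (UP.≃-sym (UP.≃-trans (QP.toℚᵘ-homo-* (ι a) (ι b)) (UP.*-cong (toℚᵘ-ι a) (toℚᵘ-ι b)))))

ι-homo-neg : ∀ a → ι (ℤ.- a) ≡ Q.- ι a
ι-homo-neg a = QP.toℚᵘ-injective (UP.≃-trans (toℚᵘ-ι (ℤ.- a))
  (UP.≃-sym (UP.≃-trans (QP.toℚᵘ-homo‿- (ι a)) (UP.-‿cong (toℚᵘ-ι a)))))

ι-mono-≤ : ∀ {a b} → a ℤ.≤ b → ι a Q.≤ ι b
ι-mono-≤ {a} {b} a≤b = QP.toℚᵘ-cancel-≤ (UP.≤-respʳ-≃ (UP.≃-sym (toℚᵘ-ι b))
  (UP.≤-respˡ-≃ (UP.≃-sym (toℚᵘ-ι a))
    (U.*≤* (subst₂ ℤ._≤_ (sym (ℤP.*-identityʳ a)) (sym (ℤP.*-identityʳ b)) a≤b))))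

ι-cancel-≤ : ∀ {a b} → ι a Q.≤ ι b → a ℤ.≤ b
ι-cancel-≤ {a} {b} p with UP.≤-respʳ-≃ (toℚᵘ-ι b) (UP.≤-respˡ-≃ (toℚᵘ-ι a) (QP.toℚᵘ-mono-≤ p))
... | U.*≤* a≤b = subst₂ ℤ._≤_ (ℤP.*-identityʳ a) (ℤP.*-identityʳ b) a≤b

ι-cancel-< : ∀ {a b} → ι a Q.< ι b → a ℤ.< b
ι-cancel-< p = ℤP.≰⇒> (λ b≤a → QP.<-irrefl refl (QP.<-≤-trans p (ι-mono-≤ b≤a)))

ι-injective : ∀ {a b} → ι a ≡ ι b → a ≡ b
ι-injective e = ℤP.≤-antisym (ι-cancel-≤ (QP.≤-reflexive e)) (ι-cancel-≤ (QP.≤-reflexive (sym e)))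

ι-nonneg : ∀ n → 0ℚ Q.≤ ι (+ n)
ι-nonneg n = ι-mono-≤ {+ 0} {+ n} (ℤ.+≤+ ℕ.z≤n)

ι-positive : ∀ d → 0 ℕ.< d → Q.Positive (ι (+ d))
ι-positive (suc d) _ = Q.positive (QP.toℚᵘ-cancel-< (UP.<-respʳ-≃ (UP.≃-sym (toℚᵘ-ι (+ suc d)))
  (UP.<-respˡ-≃ (UP.≃-sym (toℚᵘ-ι (+ 0))) (U.*<* (ℤ.+<+ (ℕ.s≤s ℕ.z≤n))))))

ratio-* : ∀ a d → 0 ℕ.< d → ratio a d Q.* ι (+ d) ≡ ι (+ a)
ratio-* a (suc d) _ = QP.toℚᵘ-injective
  (UP.≃-trans (QP.toℚᵘ-homo-* (+ a Q./ suc d) (ι (+ suc d)))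
  (UP.≃-trans (UP.*-cong (QP.toℚᵘ-fromℚᵘ (U.mkℚᵘ (+ a) d)) (toℚᵘ-ι (+ suc d)))
  (UP.≃-trans (U.*≡* cross) (UP.≃-sym (toℚᵘ-ι (+ a))))))
  where
  cross : (+ a ℤ.* + suc d) ℤ.* + 1 ≡ + a ℤ.* + (suc d ℕ.* 1)
  cross = trans (ℤP.*-identityʳ _) (cong (λ m → + a ℤ.* + m) (sym (ℕP.*-identityʳ (suc d))))

*-cancelʳ-ι : ∀ d x y → 0 ℕ.< d → x Q.* ι (+ d) ≡ y Q.* ι (+ d) → x ≡ y
*-cancelʳ-ι d x y 0<d e = QP.≤-antisym
  (QP.*-cancelʳ-≤-pos (ι (+ d)) {{ι-positive d 0<d}} (QP.≤-reflexive e))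
  (QP.*-cancelʳ-≤-pos (ι (+ d)) {{ι-positive d 0<d}} (QP.≤-reflexive (sym e)))

inverse : ∀ K → 0 ℕ.< K → Σ ℚ λ v → (v Q.* ι (+ K) ≡ 1ℚ) × (0ℚ Q.≤ v)
inverse (suc K) 0<K = ratio 1 (suc K) , ratio-* 1 (suc K) 0<K ,
  QP.nonNegative⁻¹ _ {{QP.normalize-nonNeg 1 (suc K)}}

-- Finite sums.  'sumℚ' and 'sumℤ' from Defs unfold exactly like the library
-- sum over a semiring, so the algebraic laws are imported from there; only
-- the order-theoretic facts are proved by induction.
module ∑ℚ = SemiringSum (CommutativeRing.semiring QP.+-*-commutativeRing)
module ∑ℤ = SemiringSum ℤP.+-*-semiring

sumℚ≡∑ : ∀ {k} (f : Fin k → ℚ) → sumℚ f ≡ ∑ℚ.sum f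
sumℚ≡∑ {zero} f = refl
sumℚ≡∑ {suc k} f = cong (f zero Q.+_) (sumℚ≡∑ (λ t → f (suc t)))

sum-cong : ∀ {k} {f g : Fin k → ℚ} → (∀ i → f i ≡ g i) → sumℚ f ≡ sumℚ g
sum-cong {zero} e = refl
sum-cong {suc k} e = cong₂ Q._+_ (e zero) (sum-cong (λ t → e (suc t)))

sum-+ : ∀ {k} (f g : Fin k → ℚ) → sumℚ (λ i → f i Q.+ g i) ≡ sumℚ f Q.+ sumℚ g
sum-+ f g = begin
  sumℚ (λ i → f i Q.+ g i)  ≡⟨ sumℚ≡∑ (λ i → f i Q.+ g i) ⟩
  ∑ℚ.sum (λ i → f i Q.+ g i) ≡⟨ ∑ℚ.∑-distrib-+ f g ⟩
  ∑ℚ.sum f Q.+ ∑ℚ.sum g      ≡⟨ sym (cong₂ Q._+_ (sumℚ≡∑ f) (sumℚ≡∑ g)) ⟩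
  sumℚ f Q.+ sumℚ g          ∎
  where open ≡-Reasoning

sum-*ˡ : ∀ {k} (a : ℚ) (f : Fin k → ℚ) → sumℚ (λ i → a Q.* f i) ≡ a Q.* sumℚ f
sum-*ˡ a f = begin
  sumℚ (λ i → a Q.* f i)   ≡⟨ sumℚ≡∑ (λ i → a Q.* f i) ⟩
  ∑ℚ.sum (λ i → a Q.* f i) ≡⟨ sym (∑ℚ.*-distribˡ-sum a f) ⟩
  a Q.* ∑ℚ.sum f           ≡⟨ cong (a Q.*_) (sym (sumℚ≡∑ f)) ⟩
  a Q.* sumℚ f             ∎
  where open ≡-Reasoning

sum-*ʳ : ∀ {k} (a : ℚ) (f : Fin k → ℚ) → sumℚ (λ i → f i Q.* a) ≡ sumℚ f Q.* a
sum-*ʳ a f = trans (sum-cong (λ i → QP.*-comm (f i) a)) (trans (sum-*ˡ a f) (QP.*-comm a _))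

sum-swap : ∀ {k m} (f : Fin k → Fin m → ℚ) →
  sumℚ (λ t → sumℚ (f t)) ≡ sumℚ (λ i → sumℚ (λ t → f t i))
sum-swap f = begin
  sumℚ (λ t → sumℚ (f t))               ≡⟨ sumℚ≡∑ (λ t → sumℚ (f t)) ⟩
  ∑ℚ.sum (λ t → sumℚ (f t))             ≡⟨ ∑ℚ.sum-cong-≗ (λ t → sumℚ≡∑ (f t)) ⟩
  ∑ℚ.sum (λ t → ∑ℚ.sum (f t))           ≡⟨ ∑ℚ.∑-comm f ⟩
  ∑ℚ.sum (λ i → ∑ℚ.sum (λ t → f t i))   ≡⟨ sym (∑ℚ.sum-cong-≗ (λ i → sumℚ≡∑ (λ t → f t i))) ⟩
  ∑ℚ.sum (λ i → sumℚ (λ t → f t i))     ≡⟨ sym (sumℚ≡∑ (λ i → sumℚ (λ t → f t i))) ⟩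
  sumℚ (λ i → sumℚ (λ t → f t i))       ∎
  where open ≡-Reasoning

sum-0 : ∀ {k} → sumℚ {k} (λ _ → 0ℚ) ≡ 0ℚ
sum-0 {zero} = refl
sum-0 {suc k} = trans (QP.+-identityˡ _) (sum-0 {k})

sum-neg : ∀ {k} (f : Fin k → ℚ) → sumℚ (λ i → Q.- f i) ≡ Q.- sumℚ f
sum-neg {zero} f = refl
sum-neg {suc k} f = trans (cong (Q.- f zero Q.+_) (sum-neg (λ t → f (suc t))))
  (sym (QP.neg-distrib-+ (f zero) _))

sum-ι : ∀ {k} (f : Fin k → ℤ) → sumℚ (λ i → ι (f i)) ≡ ι (sumℤ f)
sum-ι {zero} f = refl
sum-ι {suc k} f = trans (cong (ι (f zero) Q.+_) (sum-ι (λ t → f (suc t)))) (sym (ι-homo-+ (f zero) _))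

sum-const : ∀ k (e : ℚ) → sumℚ {k} (λ _ → e) ≡ ι (+ k) Q.* e
sum-const zero e = sym (QP.*-zeroˡ e)
sum-const (suc k) e = begin
  e Q.+ sumℚ {k} (λ _ → e)    ≡⟨ cong (e Q.+_) (sum-const k e) ⟩
  e Q.+ ι (+ k) Q.* e         ≡⟨ distribute e (ι (+ k)) ⟩
  (1ℚ Q.+ ι (+ k)) Q.* e      ≡⟨ cong (Q._* e) (sym (ι-homo-+ (+ 1) (+ k))) ⟩
  ι (+ suc k) Q.* e           ∎
  where
  open ≡-Reasoning
  open +-*-Solver
  distribute : ∀ e K → e Q.+ K Q.* e ≡ (1ℚ Q.+ K) Q.* e
  distribute = solve 2 (λ e K → e :+ K :* e := (con 1ℚ :+ K) :* e) refl

δ : ∀ {n} → Fin n → Fin n → ℚ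
δ j i = ι (unit j i)

δ-sym : ∀ {n} (i j : Fin n) → δ i j ≡ δ j i
δ-sym zero zero = refl
δ-sym zero (suc j) = refl
δ-sym (suc i) zero = refl
δ-sym (suc i) (suc j) = δ-sym i j

δ-diag : ∀ {n} (j : Fin n) → δ j j ≡ 1ℚ
δ-diag zero = refl
δ-diag (suc j) = δ-diag j

δ-nonneg : ∀ {n} (t s : Fin n) → 0ℚ Q.≤ δ t s
δ-nonneg zero zero = QP.nonNegative⁻¹ 1ℚ
δ-nonneg zero (suc s) = QP.≤-refl
δ-nonneg (suc t) zero = QP.≤-refl
δ-nonneg (suc t) (suc s) = δ-nonneg t s

sum-δ : ∀ {n} (f : Fin n → ℚ) (j : Fin n) → sumℚ (λ i → f i Q.* δ j i) ≡ f j
sum-δ {suc n} f zero = trans (cong₂ Q._+_ (QP.*-identityʳ (f zero))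
  (trans (sum-cong (λ t → QP.*-zeroʳ (f (suc t)))) (sum-0 {n}))) (QP.+-identityʳ _)
sum-δ {suc n} f (suc j) = trans (cong₂ Q._+_ (QP.*-zeroʳ (f zero)) (sum-δ (λ t → f (suc t)) j))
  (QP.+-identityˡ _)

sum-δ′ : ∀ {n} (f : Fin n → ℚ) (j : Fin n) → sumℚ (λ i → f i Q.* δ i j) ≡ f j
sum-δ′ f j = trans (sum-cong (λ i → cong (f i Q.*_) (δ-sym i j))) (sum-δ f j)

sum-mono : ∀ {k} {f g : Fin k → ℚ} → (∀ i → f i Q.≤ g i) → sumℚ f Q.≤ sumℚ g
sum-mono {zero} h = QP.≤-refl
sum-mono {suc k} h = QP.+-mono-≤ (h zero) (sum-mono (λ t → h (suc t)))

sum-nonneg : ∀ {k} {f : Fin k → ℚ} → (∀ i → 0ℚ Q.≤ f i) → 0ℚ Q.≤ sumℚ f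
sum-nonneg {k} {f} h = subst (Q._≤ sumℚ f) (sum-0 {k}) (sum-mono h)

term≤sum : ∀ {k} {f : Fin k → ℚ} → (∀ i → 0ℚ Q.≤ f i) → ∀ j → f j Q.≤ sumℚ f
term≤sum {suc k} {f} h zero = subst (Q._≤ sumℚ f) (QP.+-identityʳ (f zero))
  (QP.+-monoʳ-≤ (f zero) (sum-nonneg (λ t → h (suc t))))
term≤sum {suc k} {f} h (suc j) = QP.≤-trans (term≤sum (λ t → h (suc t)) j)
  (subst (Q._≤ sumℚ f) (QP.+-identityˡ (sumℚ (λ t → f (suc t))))
    (QP.+-monoˡ-≤ (sumℚ (λ t → f (suc t))) (h zero)))

nonzero-term : ∀ {k} (f : Fin k → ℚ) → sumℚ f ≢ 0ℚ → Σ (Fin k) λ j → f j ≢ 0ℚ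
nonzero-term {zero} f ne = ⊥-elim (ne refl)
nonzero-term {suc k} f ne with f zero QP.≟ 0ℚ
... | no p = zero , p
... | yes p with nonzero-term (λ t → f (suc t)) (λ e → ne (cong₂ Q._+_ p e))
... | j , q = suc j , q

sumℤ≡∑ : ∀ {k} (f : Fin k → ℤ) → sumℤ f ≡ ∑ℤ.sum f
sumℤ≡∑ {zero} f = refl
sumℤ≡∑ {suc k} f = cong (ℤ._+_ (f zero)) (sumℤ≡∑ (λ t → f (suc t)))

zsum-cong : ∀ {k} {f g : Fin k → ℤ} → (∀ i → f i ≡ g i) → sumℤ f ≡ sumℤ g
zsum-cong {zero} e = refl
zsum-cong {suc k} e = cong₂ ℤ._+_ (e zero) (zsum-cong (λ t → e (suc t)))

zsum-+ : ∀ {k} (f g : Fin k → ℤ) → sumℤ (λ i → f i ℤ.+ g i) ≡ sumℤ f ℤ.+ sumℤ g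
zsum-+ f g = begin
  sumℤ (λ i → f i ℤ.+ g i)   ≡⟨ sumℤ≡∑ (λ i → f i ℤ.+ g i) ⟩
  ∑ℤ.sum (λ i → f i ℤ.+ g i) ≡⟨ ∑ℤ.∑-distrib-+ f g ⟩
  ∑ℤ.sum f ℤ.+ ∑ℤ.sum g      ≡⟨ sym (cong₂ ℤ._+_ (sumℤ≡∑ f) (sumℤ≡∑ g)) ⟩
  sumℤ f ℤ.+ sumℤ g          ∎
  where open ≡-Reasoning

zsum-*ˡ : ∀ {k} (a : ℤ) (f : Fin k → ℤ) → sumℤ (λ i → a ℤ.* f i) ≡ a ℤ.* sumℤ f
zsum-*ˡ a f = begin
  sumℤ (λ i → a ℤ.* f i)   ≡⟨ sumℤ≡∑ (λ i → a ℤ.* f i) ⟩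
  ∑ℤ.sum (λ i → a ℤ.* f i) ≡⟨ sym (∑ℤ.*-distribˡ-sum a f) ⟩
  a ℤ.* ∑ℤ.sum f           ≡⟨ cong (a ℤ.*_) (sym (sumℤ≡∑ f)) ⟩
  a ℤ.* sumℤ f             ∎
  where open ≡-Reasoning

zsum-swap : ∀ {k m} (f : Fin k → Fin m → ℤ) →
  sumℤ (λ t → sumℤ (f t)) ≡ sumℤ (λ i → sumℤ (λ t → f t i))
zsum-swap f = begin
  sumℤ (λ t → sumℤ (f t))               ≡⟨ sumℤ≡∑ (λ t → sumℤ (f t)) ⟩
  ∑ℤ.sum (λ t → sumℤ (f t))             ≡⟨ ∑ℤ.sum-cong-≗ (λ t → sumℤ≡∑ (f t)) ⟩
  ∑ℤ.sum (λ t → ∑ℤ.sum (f t))           ≡⟨ ∑ℤ.∑-comm f ⟩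
  ∑ℤ.sum (λ i → ∑ℤ.sum (λ t → f t i))   ≡⟨ sym (∑ℤ.sum-cong-≗ (λ i → sumℤ≡∑ (λ t → f t i))) ⟩
  ∑ℤ.sum (λ i → sumℤ (λ t → f t i))     ≡⟨ sym (sumℤ≡∑ (λ i → sumℤ (λ t → f t i))) ⟩
  sumℤ (λ i → sumℤ (λ t → f t i))       ∎
  where open ≡-Reasoning

zsum-0 : ∀ {k} → sumℤ {k} (λ _ → + 0) ≡ + 0
zsum-0 {zero} = refl
zsum-0 {suc k} = trans (ℤP.+-identityˡ _) (zsum-0 {k})

zsum-neg : ∀ {k} (f : Fin k → ℤ) → sumℤ (λ t → ℤ.- f t) ≡ ℤ.- sumℤ f
zsum-neg {zero} f = refl
zsum-neg {suc k} f = trans (cong (ℤ._+_ (ℤ.- f zero)) (zsum-neg (λ t → f (suc t))))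
  (sym (ℤP.neg-distrib-+ (f zero) _))

zsum-const : ∀ m c → sumℤ {m} (λ _ → c) ≡ + m ℤ.* c
zsum-const zero c = sym (ℤP.*-zeroˡ c)
zsum-const (suc m) c = trans (cong (ℤ._+_ c) (zsum-const m c)) (sym (ℤP.suc-* (+ m) c))

zsum-mono : ∀ {k} {f g : Fin k → ℤ} → (∀ i → f i ℤ.≤ g i) → sumℤ f ℤ.≤ sumℤ g
zsum-mono {zero} h = ℤP.≤-refl
zsum-mono {suc k} h = ℤP.+-mono-≤ (h zero) (zsum-mono (λ t → h (suc t)))

zsum-nonneg : ∀ {k} {f : Fin k → ℤ} → (∀ i → + 0 ℤ.≤ f i) → + 0 ℤ.≤ sumℤ f
zsum-nonneg {k} {f} h = subst (ℤ._≤ sumℤ f) (zsum-0 {k}) (zsum-mono h)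

zterm≤sum : ∀ {k} {f : Fin k → ℤ} → (∀ i → + 0 ℤ.≤ f i) → ∀ j → f j ℤ.≤ sumℤ f
zterm≤sum {suc k} {f} h zero = subst (ℤ._≤ sumℤ f) (ℤP.+-identityʳ (f zero))
  (ℤP.+-monoʳ-≤ (f zero) (zsum-nonneg (λ t → h (suc t))))
zterm≤sum {suc k} {f} h (suc j) = ℤP.≤-trans (zterm≤sum (λ t → h (suc t)) j)
  (subst (ℤ._≤ sumℤ f) (ℤP.+-identityˡ (sumℤ (λ t → f (suc t))))
    (ℤP.+-monoˡ-≤ (sumℤ (λ t → f (suc t))) (h zero)))

znonzero-term : ∀ {k} (f : Fin k → ℤ) → sumℤ f ≢ + 0 → Σ (Fin k) λ j → f j ≢ + 0
znonzero-term {zero} f ne = ⊥-elim (ne refl)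
znonzero-term {suc k} f ne with f zero ℤ.≟ + 0
... | no p = zero , p
... | yes p with znonzero-term (λ t → f (suc t)) (λ e → ne (cong₂ ℤ._+_ p e))
... | j , q = suc j , q

nonneg-sum-zero : ∀ {k} (f : Fin k → ℤ) → (∀ i → + 0 ℤ.≤ f i) → sumℤ f ℤ.≤ + 0 →
  ∀ j → f j ≡ + 0
nonneg-sum-zero f h s j = ℤP.≤-antisym (ℤP.≤-trans (zterm≤sum h j) s) (h j)

exceptAt : ∀ {n} → Fin n → (Fin n → ℤ) → Fin n → ℤ
exceptAt j f i = if does (i Fin.≟ j) then + 0 else f i

zsum-exceptAt : ∀ {n} (f : Fin n → ℤ) (j : Fin n) → sumℤ f ≡ f j ℤ.+ sumℤ (exceptAt j f)
zsum-exceptAt {suc n} f zero =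
  cong (ℤ._+_ (f zero)) (sym (ℤP.+-identityˡ (sumℤ (λ t → f (suc t)))))
zsum-exceptAt {suc n} f (suc j) =
  trans (cong (ℤ._+_ (f zero)) (zsum-exceptAt (λ t → f (suc t)) j)) (swap (f zero) (f (suc j)) _)
  where
  swap : ∀ a b c → a ℤ.+ (b ℤ.+ c) ≡ b ℤ.+ (a ℤ.+ c)
  swap a b c = ℤSolver.solve (a ∷ b ∷ c ∷ [])

exceptAt-mono : ∀ {n} (j : Fin n) {f g : Fin n → ℤ} → (∀ i → f i ℤ.≤ g i) →
  ∀ i → exceptAt j f i ℤ.≤ exceptAt j g i
exceptAt-mono j h i with does (i Fin.≟ j)
... | true = ℤP.≤-refl
... | false = h i

exceptAt-nonneg : ∀ {n} (j : Fin n) {f : Fin n → ℤ} → (∀ i → + 0 ℤ.≤ f i) →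
  ∀ i → + 0 ℤ.≤ exceptAt j f i
exceptAt-nonneg j h i with does (i Fin.≟ j)
... | true = ℤP.≤-refl
... | false = h i

sumℕ : ∀ {k} → (Fin k → ℕ) → ℕ
sumℕ {zero} f = 0
sumℕ {suc k} f = f zero ℕ.+ sumℕ (λ t → f (suc t))

sumℤ-+ : ∀ {k} (f : Fin k → ℕ) → sumℤ (λ i → + f i) ≡ + sumℕ f
sumℤ-+ {zero} f = refl
sumℤ-+ {suc k} f = trans (cong (ℤ._+_ (+ f zero)) (sumℤ-+ (λ t → f (suc t))))
  (sym (ℤP.pos-+ (f zero) (sumℕ (λ t → f (suc t)))))

sumℕ-positive : ∀ {n} (q : Fin n → ℕ) → (∀ i → 0 ℕ.< q i) → n ℕ.≤ sumℕ q
sumℕ-positive {zero} q p = ℕ.z≤n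
sumℕ-positive {suc n} q p = ℕP.+-mono-≤ (p zero) (sumℕ-positive (λ t → q (suc t)) (λ t → p (suc t)))

*-nonneg : ∀ {a b} → 0ℚ Q.≤ a → 0ℚ Q.≤ b → 0ℚ Q.≤ a Q.* b
*-nonneg {a} {b} p r =
  QP.nonNegative⁻¹ (a Q.* b) {{QP.nonNeg*nonNeg⇒nonNeg a {{Q.nonNegative p}} b {{Q.nonNegative r}}}}

*-≤-of-≤1 : ∀ {c b} → 0ℚ Q.≤ c → b Q.≤ 1ℚ → c Q.* b Q.≤ c
*-≤-of-≤1 {c} {b} p r =
  subst (c Q.* b Q.≤_) (QP.*-identityʳ c) (QP.*-monoˡ-≤-nonNeg c {{Q.nonNegative p}} r)

nonneg-nonzero⇒positive : ∀ {d} → 0ℚ Q.≤ d → d ≢ 0ℚ → Q.Positive d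
nonneg-nonzero⇒positive {d} p ne with QP.<-cmp 0ℚ d
... | tri< 0<d _ _ = Q.positive 0<d
... | tri≈ _ 0≡d _ = ⊥-elim (ne (sym 0≡d))
... | tri> _ _ d<0 = ⊥-elim (QP.<-irrefl refl (QP.<-≤-trans d<0 p))

≤⇒0≤- : ∀ {a b} → a Q.≤ b → 0ℚ Q.≤ b Q.- a
≤⇒0≤- {a} {b} p = subst (Q._≤ b Q.- a) (QP.+-inverseʳ a) (QP.+-monoˡ-≤ (Q.- a) p)

-≤-self : ∀ a b → 0ℚ Q.≤ b → a Q.- b Q.≤ a
-≤-self a b p = subst (a Q.- b Q.≤_) (QP.+-identityʳ a) (QP.+-monoʳ-≤ a (QP.neg-antimono-≤ p))

neg-involutive : ∀ p → Q.- (Q.- p) ≡ p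
neg-involutive = solve 1 (λ p → :- (:- p) := p) refl
  where open +-*-Solver

∣∣≤⇒bounds : ∀ p ε → Q.∣ p ∣ Q.≤ ε → (Q.- ε Q.≤ p) × (p Q.≤ ε)
∣∣≤⇒bounds p ε h with QP.∣p∣≡p∨∣p∣≡-p p
... | inj₁ e = QP.≤-trans (QP.neg-antimono-≤ ε≥0) (subst (0ℚ Q.≤_) e (QP.0≤∣p∣ p)) , subst (Q._≤ ε) e h
  where
  ε≥0 : 0ℚ Q.≤ ε
  ε≥0 = QP.≤-trans (QP.0≤∣p∣ p) h
... | inj₂ e = subst (Q.- ε Q.≤_) (neg-involutive p) (QP.neg-antimono-≤ (subst (Q._≤ ε) e h)) ,
      QP.≤-trans (subst (Q._≤ Q.- 0ℚ) (neg-involutive p)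
        (QP.neg-antimono-≤ (subst (0ℚ Q.≤_) e (QP.0≤∣p∣ p)))) ε≥0
  where
  ε≥0 : 0ℚ Q.≤ ε
  ε≥0 = QP.≤-trans (QP.0≤∣p∣ p) h

*-cancel-≤ : ∀ d x y → 0 ℕ.< d → + d ℤ.* x ℤ.≤ + d ℤ.* y → x ℤ.≤ y
*-cancel-≤ (suc d) x y _ e = ℤP.*-cancelˡ-≤-pos x y (+ suc d) e

*-cancel-< : ∀ d x y → 0 ℕ.< d → + d ℤ.* x ℤ.< + d ℤ.* y → x ℤ.< y
*-cancel-< (suc d) x y _ e = ℤP.*-cancelˡ-<-nonNeg (+ suc d) e

*-cancel-≡ : ∀ d x y → 0 ℕ.< d → + d ℤ.* x ≡ + d ℤ.* y → x ≡ y
*-cancel-≡ (suc d) x y _ e = ℤP.*-cancelˡ-≡ (+ suc d) x y e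

*-cancel-nonneg : ∀ d x → 0 ℕ.< d → + 0 ℤ.≤ + d ℤ.* x → + 0 ℤ.≤ x
*-cancel-nonneg d x 0<d p = *-cancel-≤ d (+ 0) x 0<d (subst (ℤ._≤ + d ℤ.* x) (sym (ℤP.*-zeroʳ (+ d))) p)

*-cancel-pos : ∀ d x → 0 ℕ.< d → + 0 ℤ.< + d ℤ.* x → + 0 ℤ.< x
*-cancel-pos d x 0<d p = *-cancel-< d (+ 0) x 0<d (subst (ℤ._< + d ℤ.* x) (sym (ℤP.*-zeroʳ (+ d))) p)

floor-≤ : ∀ p → ι (Q.floor p) Q.≤ p
floor-≤ p@(Q.mkℚ num d _) = QP.toℚᵘ-cancel-≤ (UP.≤-respˡ-≃ (UP.≃-sym (toℚᵘ-ι (Q.floor p)))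
  (U.*≤* (subst (Q.floor p ℤ.* + suc d ℤ.≤_) (sym (ℤP.*-identityʳ num)) (ℤD.[n/d]*d≤n num (+ suc d)))))

<-floor+1 : ∀ p → p Q.< ι (Q.floor p ℤ.+ + 1)
<-floor+1 p@(Q.mkℚ num d _) = QP.toℚᵘ-cancel-< (UP.<-respʳ-≃ (UP.≃-sym (toℚᵘ-ι (Q.floor p ℤ.+ + 1)))
  (U.*<* (subst₂ ℤ._<_ (sym (ℤP.*-identityʳ num)) floor-as-div (ℤD.n<s[n/ℕd]*d num (suc d)))))
  where
  floor-as-div : ℤ.suc (num ℤ./ℕ suc d) ℤ.* + suc d ≡ (Q.floor p ℤ.+ + 1) ℤ.* + suc d
  floor-as-div = cong (ℤ._* + suc d) (trans (ℤP.+-comm (+ 1) (num ℤ./ℕ suc d))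
    (cong (ℤ._+ + 1) (sym (ℤD.div-pos-is-/ℕ num (suc d)))))

floor-remainder : ∀ p d A → 0 ℕ.< d → p Q.* ι (+ d) ≡ ι A →
  (+ 0 ℤ.≤ A ℤ.- + d ℤ.* Q.floor p) × (A ℤ.- + d ℤ.* Q.floor p ℤ.< + d)
floor-remainder p d A 0<d pd≡A = ℤP.i≤j⇒0≤j-i lower , upper
  where
  D F : ℤ
  D = + d
  F = Q.floor p
  instance
    D-positive : Q.Positive (ι D)
    D-positive = ι-positive d 0<d
    D-nonneg : Q.NonNegative (ι D)
    D-nonneg = Q.nonNegative (ι-nonneg d)
  lower : D ℤ.* F ℤ.≤ A
  lower = ι-cancel-≤ (subst₂ Q._≤_ (trans (sym (ι-homo-* F D)) (cong ι (ℤP.*-comm F D))) pd≡A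
    (QP.*-monoʳ-≤-nonNeg (ι D) (floor-≤ p)))
  A<[F+1]D : A ℤ.< (F ℤ.+ + 1) ℤ.* D
  A<[F+1]D = ι-cancel-< (subst₂ Q._<_ pd≡A (sym (ι-homo-* (F ℤ.+ + 1) D))
    (QP.*-monoˡ-<-pos (ι D) (<-floor+1 p)))
  upper : A ℤ.- D ℤ.* F ℤ.< D
  upper = subst (A ℤ.- D ℤ.* F ℤ.<_) (cancel F D) (ℤP.+-monoˡ-< (ℤ.- (D ℤ.* F)) A<[F+1]D)
    where
    cancel : ∀ F D → (F ℤ.+ + 1) ℤ.* D ℤ.+ ℤ.- (D ℤ.* F) ≡ D
    cancel F D = ℤSolver.solve (F ∷ D ∷ [])

vertex-in-hull : ∀ {k n} (W : Fin k → QPoint n) (t : Fin k) → InConvHull W (W t)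
vertex-in-hull W t = δ t , δ-nonneg t , sum-δ-one ,
  λ i → sym (trans (sum-cong (λ s → QP.*-comm (δ t s) (W s i))) (sum-δ (λ s → W s i) t))
  where
  sum-δ-one : sumℚ (δ t) ≡ 1ℚ
  sum-δ-one = trans (sum-cong (λ s → sym (QP.*-identityˡ (δ t s)))) (sum-δ (λ _ → 1ℚ) t)

dot-convex : ∀ {k n} (W : Fin k → QPoint n) (c : Fin k → ℚ) (x y : QPoint n) →
  (∀ i → x i ≡ sumℚ (λ t → c t Q.* W t i)) →
  dot x y ≡ sumℚ (λ t → c t Q.* dot (W t) y)
dot-convex W c x y x≡ = begin
  sumℚ (λ i → x i Q.* y i)                              ≡⟨ sum-cong (λ i → cong (Q._* y i) (x≡ i)) ⟩
  sumℚ (λ i → sumℚ (λ t → c t Q.* W t i) Q.* y i)       ≡⟨ sum-cong (λ i → sym (sum-*ʳ (y i) (λ t → c t Q.* W t i))) ⟩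
  sumℚ (λ i → sumℚ (λ t → c t Q.* W t i Q.* y i))       ≡⟨ sym (sum-swap (λ t i → c t Q.* W t i Q.* y i)) ⟩
  sumℚ (λ t → sumℚ (λ i → c t Q.* W t i Q.* y i))       ≡⟨ sum-cong (λ t → trans (sum-cong (λ i → QP.*-assoc (c t) (W t i) (y i)))
                                                                                (sum-*ˡ (c t) (λ i → W t i Q.* y i))) ⟩
  sumℚ (λ t → c t Q.* dot (W t) y)                      ∎
  where open ≡-Reasoning

hull-bound : ∀ {k n} (W : Fin k → QPoint n) (x y : QPoint n) →
  (∀ t → dot (W t) y Q.≤ 1ℚ) → InConvHull W x → dot x y Q.≤ 1ℚ
hull-bound W x y bound (c , c≥0 , c1 , x≡) =
  subst (dot x y Q.≤_) c1 (subst (Q._≤ sumℚ c) (sym (dot-convex W c x y x≡))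
    (sum-mono (λ t → *-≤-of-≤1 (c≥0 t) (bound t))))

average-zero⇒zero : ∀ {k} (d : Fin k → ℚ) (φ : Fin k → ℤ) → (∀ t → 0ℚ Q.≤ d t) → sumℚ d ≡ 1ℚ →
  (∀ t → + 0 ℤ.≤ φ t) → sumℚ (λ t → d t Q.* ι (φ t)) ≡ 0ℚ → Σ (Fin k) λ s → φ s ≡ + 0
average-zero⇒zero {k} d φ d≥0 d1 φ≥0 avg0 = s , ℤP.≤-antisym (ι-cancel-≤ φₛ≤0) (φ≥0 s)
  where
  pick : Σ (Fin k) λ s → d s ≢ 0ℚ
  pick = nonzero-term d (λ Σd≡0 → QP.<-irrefl refl (subst (0ℚ Q.<_) (trans (sym d1) Σd≡0) (QP.positive⁻¹ 1ℚ)))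
  s : Fin k
  s = proj₁ pick
  instance
    dₛ-positive : Q.Positive (d s)
    dₛ-positive = nonneg-nonzero⇒positive (d≥0 s) (proj₂ pick)
  terms≥0 : ∀ t → 0ℚ Q.≤ d t Q.* ι (φ t)
  terms≥0 t = *-nonneg (d≥0 t) (ι-mono-≤ (φ≥0 t))
  dφₛ≤0 : d s Q.* ι (φ s) Q.≤ d s Q.* 0ℚ
  dφₛ≤0 = subst (d s Q.* ι (φ s) Q.≤_) (trans avg0 (sym (QP.*-zeroʳ (d s)))) (term≤sum terms≥0 s)
  φₛ≤0 : ι (φ s) Q.≤ ι (+ 0)
  φₛ≤0 = QP.*-cancelˡ-≤-pos (d s) dφₛ≤0

module Simplex {n : ℕ} (q : Fin n → ℕ) where
  V : Fin (suc n) → QPoint n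
  V t = embed (Δvert q t)

  P : QPoint n → Set
  P = InConvHull V

  Σq : ℕ
  Σq = sumℕ q

  Nℤ : ℤ
  Nℤ = + suc Σq

  Nℚ : ℚ
  Nℚ = ι Nℤ

  qℚ : Fin n → ℚ
  qℚ i = ι (+ q i)

  Σqℚ : sumℚ qℚ ≡ ι (+ Σq)
  Σqℚ = trans (sum-ι (λ i → + q i)) (cong ι (sumℤ-+ q))

  Nℚ-split : Nℚ ≡ 1ℚ Q.+ ι (+ Σq)
  Nℚ-split = ι-homo-+ (+ 1) (+ Σq)

  combination-coord : ∀ (c : Fin (suc n) → ℚ) i →
    sumℚ (λ t → c t Q.* V t i) ≡ c (suc i) Q.- c zero Q.* qℚ i
  combination-coord c i = trans
    (cong₂ Q._+_ (trans (cong (c zero Q.*_) (ι-homo-neg (+ q i))) (sym (QP.neg-distribʳ-* (c zero) (qℚ i))))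
                 (sum-δ′ (λ k → c (suc k)) i))
    (QP.+-comm (Q.- (c zero Q.* qℚ i)) (c (suc i)))

  weight-suc : ∀ (c : Fin (suc n) → ℚ) (x : QPoint n) →
    (∀ i → x i ≡ sumℚ (λ t → c t Q.* V t i)) → ∀ i → c (suc i) ≡ x i Q.+ c zero Q.* qℚ i
  weight-suc c x x≡ i = begin
    c (suc i)                                              ≡⟨ split (c (suc i)) (c zero Q.* qℚ i) ⟩
    (c (suc i) Q.- c zero Q.* qℚ i) Q.+ c zero Q.* qℚ i    ≡⟨ cong (Q._+ c zero Q.* qℚ i) (sym (trans (x≡ i) (combination-coord c i))) ⟩
    x i Q.+ c zero Q.* qℚ i                                ∎
    where
    open ≡-Reasoning
    open +-*-Solver
    split : ∀ a b → a ≡ (a Q.- b) Q.+ b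
    split = solve 2 (λ a b → a := (a :- b) :+ b) refl

  weight-zero : ∀ (c : Fin (suc n) → ℚ) (x : QPoint n) → sumℚ c ≡ 1ℚ →
    (∀ i → x i ≡ sumℚ (λ t → c t Q.* V t i)) → c zero Q.* Nℚ ≡ 1ℚ Q.- sumℚ x
  weight-zero c x c1 x≡ = begin
    c zero Q.* Nℚ                                                       ≡⟨ cong (c zero Q.*_) Nℚ-split ⟩
    c zero Q.* (1ℚ Q.+ ι (+ Σq))                                        ≡⟨ rearrange (c zero) (sumℚ x) (ι (+ Σq)) ⟩
    (c zero Q.+ (sumℚ x Q.+ c zero Q.* ι (+ Σq))) Q.- sumℚ x             ≡⟨ cong (λ z → (c zero Q.+ (sumℚ x Q.+ c zero Q.* z)) Q.- sumℚ x) (sym Σqℚ) ⟩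
    (c zero Q.+ (sumℚ x Q.+ c zero Q.* sumℚ qℚ)) Q.- sumℚ x              ≡⟨ cong (λ z → (c zero Q.+ (sumℚ x Q.+ z)) Q.- sumℚ x) (sym (sum-*ˡ (c zero) qℚ)) ⟩
    (c zero Q.+ (sumℚ x Q.+ sumℚ (λ i → c zero Q.* qℚ i))) Q.- sumℚ x    ≡⟨ cong (λ z → (c zero Q.+ z) Q.- sumℚ x) (sym (sum-+ x (λ i → c zero Q.* qℚ i))) ⟩
    (c zero Q.+ sumℚ (λ i → x i Q.+ c zero Q.* qℚ i)) Q.- sumℚ x         ≡⟨ cong (λ z → (c zero Q.+ z) Q.- sumℚ x) (sum-cong (λ i → sym (weight-suc c x x≡ i))) ⟩
    sumℚ c Q.- sumℚ x                                                   ≡⟨ cong (Q._- sumℚ x) c1 ⟩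
    1ℚ Q.- sumℚ x                                                       ∎
    where
    open ≡-Reasoning
    open +-*-Solver
    rearrange : ∀ c s Q → c Q.* (1ℚ Q.+ Q) ≡ (c Q.+ (s Q.+ c Q.* Q)) Q.- s
    rearrange = solve 3 (λ c s Q → c :* (con 1ℚ :+ Q) := (c :+ (s :+ c :* Q)) :- s) refl

  dot-V₀ : ∀ (y : QPoint n) → dot (V zero) y ≡ Q.- sumℚ (λ i → qℚ i Q.* y i)
  dot-V₀ y = trans
    (sum-cong (λ i → trans (cong (Q._* y i) (ι-homo-neg (+ q i))) (sym (QP.neg-distribˡ-* (qℚ i) (y i)))))
    (sum-neg (λ i → qℚ i Q.* y i))

  dot-Vsuc : ∀ (k : Fin n) (y : QPoint n) → dot (V (suc k)) y ≡ y k
  dot-Vsuc k y = trans (sum-cong (λ i → QP.*-comm (δ k i) (y i))) (sum-δ y k)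

  -- The integer a(x) = 1 - Σ x = N c_0 of a lattice point x.
  deficit : ZPoint n → ℤ
  deficit x = + 1 ℤ.- sumℤ x

  -- A lattice point of Δ has a(x) ≥ 0 and N x_i + a(x) q_i ≥ 0 (these are N
  -- times its barycentric weights).
  lattice-point-bounds : (x : ZPoint n) → P (embed x) →
    (+ 0 ℤ.≤ deficit x) × (∀ i → + 0 ℤ.≤ Nℤ ℤ.* x i ℤ.+ deficit x ℤ.* + q i)
  lattice-point-bounds x (c , c≥0 , c1 , x≡) =
    ι-cancel-≤ (subst (0ℚ Q.≤_) c₀N (*-nonneg (c≥0 zero) (ι-nonneg (suc Σq)))) ,
    λ i → ι-cancel-≤ (subst (0ℚ Q.≤_) (cᵢN i) (*-nonneg (c≥0 (suc i)) (ι-nonneg (suc Σq))))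
    where
    c₀N : c zero Q.* Nℚ ≡ ι (deficit x)
    c₀N = trans (weight-zero c (embed x) c1 x≡)
      (trans (cong (Q._-_ 1ℚ) (sum-ι x))
      (trans (cong (1ℚ Q.+_) (sym (ι-homo-neg (sumℤ x)))) (sym (ι-homo-+ (+ 1) (ℤ.- sumℤ x)))))
    cᵢN : ∀ i → c (suc i) Q.* Nℚ ≡ ι (Nℤ ℤ.* x i ℤ.+ deficit x ℤ.* + q i)
    cᵢN i = begin
      c (suc i) Q.* Nℚ                                ≡⟨ cong (Q._* Nℚ) (weight-suc c (embed x) x≡ i) ⟩
      (ι (x i) Q.+ c zero Q.* qℚ i) Q.* Nℚ            ≡⟨ rearrange (ι (x i)) (c zero) (qℚ i) Nℚ ⟩
      Nℚ Q.* ι (x i) Q.+ (c zero Q.* Nℚ) Q.* qℚ i     ≡⟨ cong (λ z → Nℚ Q.* ι (x i) Q.+ z Q.* qℚ i) c₀N ⟩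
      Nℚ Q.* ι (x i) Q.+ ι (deficit x) Q.* qℚ i       ≡⟨ sym (cong₂ Q._+_ (ι-homo-* Nℤ (x i)) (ι-homo-* (deficit x) (+ q i))) ⟩
      ι (Nℤ ℤ.* x i) Q.+ ι (deficit x ℤ.* + q i)      ≡⟨ sym (ι-homo-+ (Nℤ ℤ.* x i) (deficit x ℤ.* + q i)) ⟩
      ι (Nℤ ℤ.* x i ℤ.+ deficit x ℤ.* + q i)          ∎
      where
      open ≡-Reasoning
      open +-*-Solver
      rearrange : ∀ a b c d → (a Q.+ b Q.* c) Q.* d ≡ d Q.* a Q.+ (b Q.* d) Q.* c
      rearrange = solve 4 (λ a b c d → (a :+ b :* c) :* d := d :* a :+ (b :* d) :* c) refl

module Remainders {n : ℕ} (q : Fin n → ℕ) (j : Fin n) (0<qⱼ : 0 ℕ.< q j) where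
  open Simplex q

  quot : Fin n → ℤ
  quot i = Q.floor (ratio (q i) (q j))

  rem : Fin n → ℤ
  rem i = + q i ℤ.- + q j ℤ.* quot i

  R : ℤ
  R = sumℤ (exceptAt j rem)

  Σquot : ℤ
  Σquot = sumℤ quot

  rem-bounds : ∀ i → (+ 0 ℤ.≤ rem i) × (rem i ℤ.< + q j)
  rem-bounds i = floor-remainder (ratio (q i) (q j)) (q j) (+ q i) 0<qⱼ (ratio-* (q i) (q j) 0<qⱼ)

  rem-self : rem j ≡ + 0
  rem-self = trans (factor (+ q j) (quot j)) (trans (cong (+ q j ℤ.*_) one-minus-quot≡0) (ℤP.*-zeroʳ (+ q j)))
    where
    factor : ∀ d F → d ℤ.- d ℤ.* F ≡ d ℤ.* (+ 1 ℤ.- F)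
    factor d F = ℤSolver.solve (d ∷ F ∷ [])
    k : ℤ
    k = + 1 ℤ.- quot j
    0≤k : + 0 ℤ.≤ k
    0≤k = *-cancel-nonneg (q j) k 0<qⱼ (subst (+ 0 ℤ.≤_) (factor (+ q j) (quot j)) (proj₁ (rem-bounds j)))
    k<1 : k ℤ.< + 1
    k<1 = *-cancel-< (q j) k (+ 1) 0<qⱼ (subst₂ ℤ._<_ (factor (+ q j) (quot j)) (sym (ℤP.*-identityʳ (+ q j)))
      (proj₂ (rem-bounds j)))
    one-minus-quot≡0 : k ≡ + 0
    one-minus-quot≡0 = ℤP.≤-antisym (ℤP.i<j⇒i≤pred[j] k<1) 0≤k

  Σrem≡R : sumℤ rem ≡ R
  Σrem≡R = trans (zsum-exceptAt rem j) (trans (cong (ℤ._+ R) rem-self) (ℤP.+-identityˡ R))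

  Σrem≡ : sumℤ rem ≡ + Σq ℤ.- + q j ℤ.* Σquot
  Σrem≡ = begin
    sumℤ rem                                               ≡⟨ zsum-cong (λ i → cong (ℤ._+_ (+ q i)) (ℤP.neg-distribˡ-* (+ q j) (quot i))) ⟩
    sumℤ (λ i → + q i ℤ.+ (ℤ.- + q j) ℤ.* quot i)          ≡⟨ zsum-+ (λ i → + q i) (λ i → (ℤ.- + q j) ℤ.* quot i) ⟩
    sumℤ (λ i → + q i) ℤ.+ sumℤ (λ i → (ℤ.- + q j) ℤ.* quot i) ≡⟨ cong₂ ℤ._+_ (sumℤ-+ q) (zsum-*ˡ (ℤ.- + q j) quot) ⟩
    + Σq ℤ.+ (ℤ.- + q j) ℤ.* Σquot                         ≡⟨ cong (ℤ._+_ (+ Σq)) (sym (ℤP.neg-distribˡ-* (+ q j) Σquot)) ⟩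
    + Σq ℤ.- + q j ℤ.* Σquot                               ∎
    where open ≡-Reasoning

  N≡1+R+qⱼΣquot : Nℤ ≡ (+ 1 ℤ.+ R) ℤ.+ + q j ℤ.* Σquot
  N≡1+R+qⱼΣquot = begin
    + 1 ℤ.+ + Σq                                        ≡⟨ regroup (+ Σq) (+ q j ℤ.* Σquot) ⟩
    + 1 ℤ.+ (+ Σq ℤ.- + q j ℤ.* Σquot) ℤ.+ + q j ℤ.* Σquot ≡⟨ cong (λ z → + 1 ℤ.+ z ℤ.+ + q j ℤ.* Σquot) (trans (sym Σrem≡) Σrem≡R) ⟩
    + 1 ℤ.+ R ℤ.+ + q j ℤ.* Σquot                       ∎
    where
    open ≡-Reasoning
    regroup : ∀ Q b → + 1 ℤ.+ Q ≡ + 1 ℤ.+ (Q ℤ.- b) ℤ.+ b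
    regroup Q b = ℤSolver.solve (Q ∷ b ∷ [])

  LHS : ℚ
  LHS = ratio 1 (q j) Q.+ sumExcept j (λ i → frac (ratio (q i) (q j)))

  qⱼℚ : ℚ
  qⱼℚ = ι (+ q j)

  frac-scaled : ∀ i → frac (ratio (q i) (q j)) Q.* qⱼℚ ≡ ι (rem i)
  frac-scaled i = begin
    (p Q.- ι (quot i)) Q.* qⱼℚ                  ≡⟨ distribute p (ι (quot i)) qⱼℚ ⟩
    p Q.* qⱼℚ Q.- qⱼℚ Q.* ι (quot i)            ≡⟨ cong₂ Q._-_ (ratio-* (q i) (q j) 0<qⱼ) (sym (ι-homo-* (+ q j) (quot i))) ⟩
    ι (+ q i) Q.- ι (+ q j ℤ.* quot i)          ≡⟨ cong (ι (+ q i) Q.+_) (sym (ι-homo-neg (+ q j ℤ.* quot i))) ⟩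
    ι (+ q i) Q.+ ι (ℤ.- (+ q j ℤ.* quot i))    ≡⟨ sym (ι-homo-+ (+ q i) (ℤ.- (+ q j ℤ.* quot i))) ⟩
    ι (rem i)                                   ∎
    where
    p : ℚ
    p = ratio (q i) (q j)
    open ≡-Reasoning
    open +-*-Solver
    distribute : ∀ a b c → (a Q.- b) Q.* c ≡ a Q.* c Q.- c Q.* b
    distribute = solve 3 (λ a b c → (a :- b) :* c := a :* c :- c :* b) refl

  LHS-scaled : LHS Q.* qⱼℚ ≡ ι (+ 1 ℤ.+ R)
  LHS-scaled = begin
    LHS Q.* qⱼℚ                                                ≡⟨ QP.*-distribʳ-+ qⱼℚ (ratio 1 (q j)) _ ⟩
    ratio 1 (q j) Q.* qⱼℚ Q.+ sumℚ fracs Q.* qⱼℚ               ≡⟨ cong₂ Q._+_ (ratio-* 1 (q j) 0<qⱼ) (sym (sum-*ʳ qⱼℚ fracs)) ⟩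
    ι (+ 1) Q.+ sumℚ (λ i → fracs i Q.* qⱼℚ)                   ≡⟨ cong (ι (+ 1) Q.+_) (trans (sum-cong scaled) (sum-ι (exceptAt j rem))) ⟩
    ι (+ 1) Q.+ ι R                                            ≡⟨ sym (ι-homo-+ (+ 1) R) ⟩
    ι (+ 1 ℤ.+ R)                                              ∎
    where
    open ≡-Reasoning
    fracs : Fin n → ℚ
    fracs i = if does (i Fin.≟ j) then 0ℚ else frac (ratio (q i) (q j))
    scaled : ∀ i → fracs i Q.* qⱼℚ ≡ ι (exceptAt j rem i)
    scaled i with does (i Fin.≟ j)
    ... | true = QP.*-zeroˡ qⱼℚ
    ... | false = frac-scaled i

  Eqn⇒1+R≡qⱼ : Eqn q j → + 1 ℤ.+ R ≡ + q j
  Eqn⇒1+R≡qⱼ e = ι-injective (trans (sym LHS-scaled) (trans (cong (Q._* qⱼℚ) e) (QP.*-identityˡ qⱼℚ)))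

  1+R≡qⱼ⇒Eqn : + 1 ℤ.+ R ≡ + q j → Eqn q j
  1+R≡qⱼ⇒Eqn e = *-cancelʳ-ι (q j) LHS 1ℚ 0<qⱼ
    (trans LHS-scaled (trans (cong ι e) (sym (QP.*-identityˡ qⱼℚ))))

  Eqn⇒N≡qⱼ* : Eqn q j → Nℤ ≡ + q j ℤ.* (+ 1 ℤ.+ Σquot)
  Eqn⇒N≡qⱼ* e = begin
    Nℤ                                ≡⟨ N≡1+R+qⱼΣquot ⟩
    (+ 1 ℤ.+ R) ℤ.+ + q j ℤ.* Σquot   ≡⟨ cong (ℤ._+ + q j ℤ.* Σquot) (Eqn⇒1+R≡qⱼ e) ⟩
    + q j ℤ.+ + q j ℤ.* Σquot         ≡⟨ factor (+ q j) Σquot ⟩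
    + q j ℤ.* (+ 1 ℤ.+ Σquot)         ∎
    where
    open ≡-Reasoning
    factor : ∀ a G → a ℤ.+ a ℤ.* G ≡ a ℤ.* (+ 1 ℤ.+ G)
    factor a G = ℤSolver.solve (a ∷ G ∷ [])

-- The facet of Δ opposite e_j has the dual vertex u = 1 - (N/q_j) e_j in the
-- polar.  If the polar is a lattice polytope, u is a convex combination of
-- integer points z of the polar, on which φ(z) = q_j z_j + N - q_j ≥ 0 while
-- φ(u) = 0; hence φ(z) = 0 for one of them, i.e. N = q_j (1 - z_j).
module FacetVertex {n : ℕ} (q : Fin n → ℕ) (pos : Positive q) (j : Fin n) where
  open Simplex q

  s : ℚ
  s = ratio (suc Σq) (q j)

  sqⱼ≡N : s Q.* qℚ j ≡ Nℚ
  sqⱼ≡N = ratio-* (suc Σq) (q j) (pos j)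

  s≥0 : 0ℚ Q.≤ s
  s≥0 = QP.*-cancelʳ-≤-pos (qℚ j) {{ι-positive (q j) (pos j)}}
    (subst₂ Q._≤_ (sym (QP.*-zeroˡ (qℚ j))) (sym sqⱼ≡N) (ι-nonneg (suc Σq)))

  u : QPoint n
  u i = 1ℚ Q.- s Q.* δ j i

  u-in-polar : Polar P u
  u-in-polar x x∈P = hull-bound V x u bound x∈P
    where
    bound : ∀ t → dot (V t) u Q.≤ 1ℚ
    bound zero = QP.≤-reflexive (begin
      dot (V zero) u                                                ≡⟨ dot-V₀ u ⟩
      Q.- sumℚ (λ i → qℚ i Q.* (1ℚ Q.- s Q.* δ j i))                 ≡⟨ cong Q.-_ (sum-cong (λ i → expand (qℚ i) s (δ j i))) ⟩
      Q.- sumℚ (λ i → qℚ i Q.+ Q.- (s Q.* (qℚ i Q.* δ j i)))         ≡⟨ cong Q.-_ (sum-+ qℚ (λ i → Q.- (s Q.* (qℚ i Q.* δ j i)))) ⟩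
      Q.- (sumℚ qℚ Q.+ sumℚ (λ i → Q.- (s Q.* (qℚ i Q.* δ j i))))     ≡⟨ cong (λ z → Q.- (sumℚ qℚ Q.+ z)) pick-j ⟩
      Q.- (sumℚ qℚ Q.+ Q.- (s Q.* qℚ j))                              ≡⟨ cong₂ (λ a b → Q.- (a Q.+ Q.- b)) Σqℚ sqⱼ≡N ⟩
      Q.- (ι (+ Σq) Q.+ Q.- Nℚ)                                       ≡⟨ cong (λ z → Q.- (ι (+ Σq) Q.+ Q.- z)) Nℚ-split ⟩
      Q.- (ι (+ Σq) Q.+ Q.- (1ℚ Q.+ ι (+ Σq)))                        ≡⟨ simplify (ι (+ Σq)) ⟩
      1ℚ                                                             ∎)
      where
      open ≡-Reasoning
      open +-*-Solver
      expand : ∀ a b c → a Q.* (1ℚ Q.- b Q.* c) ≡ a Q.+ Q.- (b Q.* (a Q.* c))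
      expand = solve 3 (λ a b c → a :* (con 1ℚ :- b :* c) := a :+ :- (b :* (a :* c))) refl
      simplify : ∀ a → Q.- (a Q.+ Q.- (1ℚ Q.+ a)) ≡ 1ℚ
      simplify = solve 1 (λ a → :- (a :+ :- (con 1ℚ :+ a)) := con 1ℚ) refl
      pick-j : sumℚ (λ i → Q.- (s Q.* (qℚ i Q.* δ j i))) ≡ Q.- (s Q.* qℚ j)
      pick-j = trans (sum-neg (λ i → s Q.* (qℚ i Q.* δ j i)))
        (cong Q.-_ (trans (sum-*ˡ s (λ i → qℚ i Q.* δ j i)) (cong (s Q.*_) (sum-δ qℚ j))))
    bound (suc k) = subst (Q._≤ 1ℚ) (sym (dot-Vsuc k u))
      (-≤-self 1ℚ (s Q.* δ j k) (*-nonneg s≥0 (δ-nonneg j k)))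

  φ : ZPoint n → ℤ
  φ z = + q j ℤ.* z j ℤ.+ (Nℤ ℤ.- + q j)

  -- φ ≥ 0 on lattice points of the polar: pairing with the vertices gives
  -- Σ q_i z_i ≥ -1 and z_i ≤ 1.
  φ-nonneg : (z : ZPoint n) → Polar P (embed z) → + 0 ℤ.≤ φ z
  φ-nonneg z z∈P° = ℤP.≤-trans (ℤP.i≤j⇒0≤j-i -S≤1) (subst₂ ℤ._≤_ (negate S) (sym φ≡) (ℤP.+-monoʳ-≤ (+ 1) S≤))
    where
    qz : Fin n → ℤ
    qz i = + q i ℤ.* z i
    S E : ℤ
    S = sumℤ qz
    E = sumℤ (exceptAt j (λ i → + q i))
    -S≤1 : ℤ.- S ℤ.≤ + 1
    -S≤1 = ι-cancel-≤ (subst (Q._≤ 1ℚ)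
      (trans (dot-V₀ (embed z)) (trans (cong Q.-_ (trans (sum-cong (λ i → sym (ι-homo-* (+ q i) (z i)))) (sum-ι qz)))
        (sym (ι-homo-neg S))))
      (z∈P° (V zero) (vertex-in-hull V zero)))
    zᵢ≤1 : ∀ i → z i ℤ.≤ + 1
    zᵢ≤1 i = ι-cancel-≤ (subst (Q._≤ 1ℚ) (dot-Vsuc i (embed z)) (z∈P° (V (suc i)) (vertex-in-hull V (suc i))))
    S≤ : S ℤ.≤ qz j ℤ.+ E
    S≤ = subst (ℤ._≤ qz j ℤ.+ E) (sym (zsum-exceptAt qz j)) (ℤP.+-monoʳ-≤ (qz j) (zsum-mono (exceptAt-mono j
      (λ i → subst (qz i ℤ.≤_) (ℤP.*-identityʳ (+ q i)) (ℤP.*-monoˡ-≤-nonNeg (+ q i) (zᵢ≤1 i))))))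
    negate : ∀ S → + 1 ℤ.+ S ≡ + 1 ℤ.- ℤ.- S
    negate S = ℤSolver.solve (S ∷ [])
    φ≡ : φ z ≡ + 1 ℤ.+ (qz j ℤ.+ E)
    φ≡ = trans (cong (λ w → qz j ℤ.+ (+ 1 ℤ.+ w ℤ.- + q j)) (trans (sym (sumℤ-+ q)) (zsum-exceptAt (λ i → + q i) j)))
      (regroup (qz j) (+ q j) E)
      where
      regroup : ∀ a b c → a ℤ.+ (+ 1 ℤ.+ (b ℤ.+ c) ℤ.- b) ≡ + 1 ℤ.+ (a ℤ.+ c)
      regroup a b c = ℤSolver.solve (a ∷ b ∷ c ∷ [])

  φ-average : ∀ {k} (W : Fin k → ZPoint n) (d : Fin k → ℚ) → sumℚ d ≡ 1ℚ →
    (∀ i → u i ≡ sumℚ (λ t → d t Q.* embed (W t) i)) → sumℚ (λ t → d t Q.* ι (φ (W t))) ≡ 0ℚ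
  φ-average W d d1 u≡ = begin
    sumℚ (λ t → d t Q.* ι (φ (W t)))                            ≡⟨ sum-cong expand ⟩
    sumℚ (λ t → qℚ j Q.* (d t Q.* ι (W t j)) Q.+ d t Q.* M)      ≡⟨ sum-+ (λ t → qℚ j Q.* (d t Q.* ι (W t j))) (λ t → d t Q.* M) ⟩
    sumℚ (λ t → qℚ j Q.* (d t Q.* ι (W t j))) Q.+ sumℚ (λ t → d t Q.* M)
                                                                ≡⟨ cong₂ Q._+_ (sum-*ˡ (qℚ j) (λ t → d t Q.* ι (W t j))) (sum-*ʳ M d) ⟩
    qℚ j Q.* sumℚ (λ t → d t Q.* ι (W t j)) Q.+ sumℚ d Q.* M     ≡⟨ cong₂ (λ a b → qℚ j Q.* a Q.+ b Q.* M) (sym (u≡ j)) d1 ⟩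
    qℚ j Q.* (1ℚ Q.- s Q.* δ j j) Q.+ 1ℚ Q.* M                   ≡⟨ cong₂ (λ a b → qℚ j Q.* (1ℚ Q.- s Q.* a) Q.+ 1ℚ Q.* b) (δ-diag j) M≡ ⟩
    qℚ j Q.* (1ℚ Q.- s Q.* 1ℚ) Q.+ 1ℚ Q.* (Nℚ Q.- qℚ j)          ≡⟨ simplify (qℚ j) s Nℚ ⟩
    Nℚ Q.- s Q.* qℚ j                                           ≡⟨ cong (Q._-_ Nℚ) sqⱼ≡N ⟩
    Nℚ Q.- Nℚ                                                   ≡⟨ QP.+-inverseʳ Nℚ ⟩
    0ℚ                                                          ∎
    where
    open ≡-Reasoning
    open +-*-Solver
    M : ℚ
    M = ι (Nℤ ℤ.- + q j)
    M≡ : M ≡ Nℚ Q.- qℚ j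
    M≡ = trans (ι-homo-+ Nℤ (ℤ.- + q j)) (cong (Nℚ Q.+_) (ι-homo-neg (+ q j)))
    distribute : ∀ a b c m → a Q.* (b Q.* c Q.+ m) ≡ b Q.* (a Q.* c) Q.+ a Q.* m
    distribute = solve 4 (λ a b c m → a :* (b :* c :+ m) := b :* (a :* c) :+ a :* m) refl
    expand : ∀ t → d t Q.* ι (φ (W t)) ≡ qℚ j Q.* (d t Q.* ι (W t j)) Q.+ d t Q.* M
    expand t = trans (cong (d t Q.*_) (trans (ι-homo-+ (+ q j ℤ.* W t j) (Nℤ ℤ.- + q j))
      (cong (Q._+ M) (ι-homo-* (+ q j) (W t j))))) (distribute (d t) (qℚ j) (ι (W t j)) M)
    simplify : ∀ a b c → a Q.* (1ℚ Q.- b Q.* 1ℚ) Q.+ 1ℚ Q.* (c Q.- a) ≡ c Q.- b Q.* a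
    simplify = solve 3 (λ a b c → a :* (con 1ℚ :- b :* con 1ℚ) :+ con 1ℚ :* (c :- a) := c :- b :* a) refl

  reflexive⇒qⱼ∣N : Reflexive (Δvert q) → Σ ℤ λ h → Nℤ ≡ + q j ℤ.* h
  reflexive⇒qⱼ∣N (_ , _ , (k , W , P°≡hull)) = (+ 1 ℤ.- W t j) , N≡
    where
    u∈hull : InConvHull (λ t → embed (W t)) u
    u∈hull = Equivalence.to (P°≡hull u) u-in-polar
    d : Fin k → ℚ
    d = proj₁ u∈hull
    φW≥0 : ∀ t → + 0 ℤ.≤ φ (W t)
    φW≥0 t = φ-nonneg (W t) (Equivalence.from (P°≡hull (embed (W t))) (vertex-in-hull (λ t → embed (W t)) t))
    zero-at : Σ (Fin k) λ t → φ (W t) ≡ + 0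
    zero-at = average-zero⇒zero d (λ t → φ (W t)) (proj₁ (proj₂ u∈hull)) (proj₁ (proj₂ (proj₂ u∈hull))) φW≥0
      (φ-average W d (proj₁ (proj₂ (proj₂ u∈hull))) (proj₂ (proj₂ (proj₂ u∈hull))))
    t : Fin k
    t = proj₁ zero-at
    N≡ : Nℤ ≡ + q j ℤ.* (+ 1 ℤ.- W t j)
    N≡ = trans (unfold Nℤ (+ q j) (W t j)) (trans (cong (λ e → e ℤ.- (+ q j ℤ.* W t j) ℤ.+ + q j) (proj₂ zero-at))
      (factor (+ q j) (W t j)))
      where
      unfold : ∀ N a w → N ≡ (a ℤ.* w ℤ.+ (N ℤ.- a)) ℤ.- (a ℤ.* w) ℤ.+ a
      unfold N a w = ℤSolver.solve (N ∷ a ∷ w ∷ [])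
      factor : ∀ a w → + 0 ℤ.- (a ℤ.* w) ℤ.+ a ≡ a ℤ.* (+ 1 ℤ.- w)
      factor a w = ℤSolver.solve (a ∷ w ∷ [])

-- If 1 + R = q_j m, then w = -⌊q/q_j⌋ lies in mΔ: w/m has weights
-- c_0 = 1/(q_j m) and c_{i+1} = r_i/(q_j m), which sum to (1 + Σ r)/(q_j m) = 1.
module FloorPoint {n : ℕ} (q : Fin n → ℕ) (j : Fin n) (0<qⱼ : 0 ℕ.< q j)
                  (m : ℕ) (0<m : 0 ℕ.< m) (1+R≡qⱼm : + 1 ℤ.+ Remainders.R q j 0<qⱼ ≡ + q j ℤ.* + m) where
  open Simplex q
  open Remainders q j 0<qⱼ

  w : ZPoint n
  w i = ℤ.- quot i

  K : ℕ
  K = q j ℕ.* m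

  1/K : Σ ℚ λ v → (v Q.* ι (+ K) ≡ 1ℚ) × (0ℚ Q.≤ v)
  1/K = inverse K (ℕP.*-mono-< 0<qⱼ 0<m)

  v : ℚ
  v = proj₁ 1/K

  vK≡1 : v Q.* ι (+ K) ≡ 1ℚ
  vK≡1 = proj₁ (proj₂ 1/K)

  qⱼm≡K : + q j ℤ.* + m ≡ + K
  qⱼm≡K = sym (ℤP.pos-* (q j) m)

  c : Fin (suc n) → ℚ
  c zero = v
  c (suc i) = ι (rem i) Q.* v

  y : QPoint n
  y i = ι (ℤ.- (+ q j ℤ.* quot i)) Q.* v

  c≥0 : ∀ t → 0ℚ Q.≤ c t
  c≥0 zero = proj₂ (proj₂ 1/K)
  c≥0 (suc i) = *-nonneg (ι-mono-≤ (proj₁ (rem-bounds i))) (c≥0 zero)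

  Σc≡1 : sumℚ c ≡ 1ℚ
  Σc≡1 = begin
    v Q.+ sumℚ (λ i → ι (rem i) Q.* v)  ≡⟨ cong (v Q.+_) (trans (sum-*ʳ v (λ i → ι (rem i))) (cong (Q._* v) (sum-ι rem))) ⟩
    v Q.+ ι (sumℤ rem) Q.* v            ≡⟨ factor v (ι (sumℤ rem)) ⟩
    (1ℚ Q.+ ι (sumℤ rem)) Q.* v         ≡⟨ cong (Q._* v) (trans (sym (ι-homo-+ (+ 1) (sumℤ rem)))
                                             (cong ι (trans (cong (ℤ._+_ (+ 1)) Σrem≡R) (trans 1+R≡qⱼm qⱼm≡K)))) ⟩
    ι (+ K) Q.* v                       ≡⟨ trans (QP.*-comm (ι (+ K)) v) vK≡1 ⟩
    1ℚ                                  ∎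
    where
    open ≡-Reasoning
    open +-*-Solver
    factor : ∀ v r → v Q.+ r Q.* v ≡ (1ℚ Q.+ r) Q.* v
    factor = solve 2 (λ v r → v :+ r :* v := (con 1ℚ :+ r) :* v) refl

  y-coord : ∀ i → y i ≡ sumℚ (λ t → c t Q.* V t i)
  y-coord i = sym (trans (combination-coord c i)
    (trans (cong (λ z → z Q.* v Q.- v Q.* qℚ i) (ι-homo-+ (+ q i) (ℤ.- (+ q j ℤ.* quot i))))
           (cancel (qℚ i) (ι (ℤ.- (+ q j ℤ.* quot i))) v)))
    where
    open +-*-Solver
    cancel : ∀ a b v → (a Q.+ b) Q.* v Q.- v Q.* a ≡ b Q.* v
    cancel = solve 3 (λ a b v → (a :+ b) :* v :- v :* a := b :* v) refl

  w≡my : ∀ i → embed w i ≡ (+ m Q./ 1) Q.* y i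
  w≡my i = sym (begin
    ι (+ m) Q.* (ι (ℤ.- (+ q j ℤ.* quot i)) Q.* v)     ≡⟨ cong (λ z → ι (+ m) Q.* (z Q.* v))
                                                          (trans (cong ι (ℤP.neg-distribʳ-* (+ q j) (quot i))) (ι-homo-* (+ q j) (ℤ.- quot i))) ⟩
    ι (+ m) Q.* (ι (+ q j) Q.* ι (ℤ.- quot i) Q.* v)   ≡⟨ regroup (ι (+ m)) (ι (+ q j)) (ι (ℤ.- quot i)) v ⟩
    ι (ℤ.- quot i) Q.* (v Q.* (ι (+ q j) Q.* ι (+ m))) ≡⟨ cong (λ z → ι (ℤ.- quot i) Q.* (v Q.* z))
                                                          (trans (sym (ι-homo-* (+ q j) (+ m))) (cong ι qⱼm≡K)) ⟩
    ι (ℤ.- quot i) Q.* (v Q.* ι (+ K))                 ≡⟨ cong (ι (ℤ.- quot i) Q.*_) vK≡1 ⟩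
    ι (ℤ.- quot i) Q.* 1ℚ                              ≡⟨ QP.*-identityʳ _ ⟩
    ι (ℤ.- quot i)                                     ∎)
    where
    open ≡-Reasoning
    open +-*-Solver
    regroup : ∀ a b f v → a Q.* (b Q.* f Q.* v) ≡ f Q.* (v Q.* (b Q.* a))
    regroup = solve 4 (λ a b f v → a :* (b :* f :* v) := f :* (v :* (b :* a))) refl

  w∈mΔ : InDilate m V (embed w)
  w∈mΔ = y , (c , c≥0 , Σc≡1 , y-coord) , w≡my

-- Suppose N = q_j h and m = h - Σ_i ⌊q_i/q_j⌋, and w = -⌊q/q_j⌋ is a sum of m
-- lattice points x_t of Δ, with deficits a_t and N x_{t,i} + a_t q_i ≥ 0.
-- Then Σ a_t = h, the j-th inequalities are all equalities, so a point with
-- a_t ≠ 0 has a_t = h, hence x_t ≥ w coordinatewise, and summing gives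
-- 1 - h ≥ -Σ⌊q_i/q_j⌋, i.e. m ≤ 1.
module FloorPointDecomposition {n : ℕ} (q : Fin n → ℕ) (j : Fin n) (0<qⱼ : 0 ℕ.< q j)
    (h : ℕ) (0<h : 0 ℕ.< h) (N≡qⱼh : Simplex.Nℤ q ≡ + q j ℤ.* + h)
    (m : ℕ) (m≡h-Σquot : + m ≡ + h ℤ.- Remainders.Σquot q j 0<qⱼ)
    (xs : Fin m → ZPoint n) (xs∈Δ : ∀ t → Simplex.P q (embed (xs t)))
    (Σxs≡w : ∀ i → ℤ.- Remainders.quot q j 0<qⱼ i ≡ sumℤ (λ t → xs t i)) where
  open Simplex q
  open Remainders q j 0<qⱼ

  a : Fin m → ℤ
  a t = deficit (xs t)

  a≥0 : ∀ t → + 0 ℤ.≤ a t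
  a≥0 t = proj₁ (lattice-point-bounds (xs t) (xs∈Δ t))

  g : Fin m → Fin n → ℤ
  g t i = Nℤ ℤ.* xs t i ℤ.+ a t ℤ.* + q i

  g≥0 : ∀ t i → + 0 ℤ.≤ g t i
  g≥0 t = proj₂ (lattice-point-bounds (xs t) (xs∈Δ t))

  Σa≡h : sumℤ a ≡ + h
  Σa≡h = begin
    sumℤ (λ t → + 1 ℤ.+ ℤ.- sumℤ (xs t))                       ≡⟨ zsum-+ (λ _ → + 1) (λ t → ℤ.- sumℤ (xs t)) ⟩
    sumℤ {m} (λ _ → + 1) ℤ.+ sumℤ (λ t → ℤ.- sumℤ (xs t))      ≡⟨ cong₂ ℤ._+_ (trans (zsum-const m (+ 1)) (ℤP.*-identityʳ (+ m)))
                                                                           (zsum-neg (λ t → sumℤ (xs t))) ⟩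
    + m ℤ.+ ℤ.- sumℤ (λ t → sumℤ (xs t))                       ≡⟨ cong (λ z → + m ℤ.+ ℤ.- z) Σxs≡-Σquot ⟩
    + m ℤ.+ ℤ.- ℤ.- Σquot                                      ≡⟨ cong₂ ℤ._+_ m≡h-Σquot (ℤP.neg-involutive Σquot) ⟩
    (+ h ℤ.- Σquot) ℤ.+ Σquot                                  ≡⟨ cancel (+ h) Σquot ⟩
    + h                                                        ∎
    where
    open ≡-Reasoning
    cancel : ∀ h G → (h ℤ.- G) ℤ.+ G ≡ h
    cancel h G = ℤSolver.solve (h ∷ G ∷ [])
    Σxs≡-Σquot : sumℤ (λ t → sumℤ (xs t)) ≡ ℤ.- Σquot
    Σxs≡-Σquot = trans (zsum-swap (λ t i → xs t i)) (trans (zsum-cong (λ i → sym (Σxs≡w i))) (zsum-neg quot))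

  -- Σ_t g_{t,j} = N (-⌊q_j/q_j⌋) + q_j h = h r_j = 0.
  Σgⱼ≡0 : sumℤ (λ t → g t j) ≡ + 0
  Σgⱼ≡0 = begin
    sumℤ (λ t → g t j)                                         ≡⟨ zsum-+ (λ t → Nℤ ℤ.* xs t j) (λ t → a t ℤ.* + q j) ⟩
    sumℤ (λ t → Nℤ ℤ.* xs t j) ℤ.+ sumℤ (λ t → a t ℤ.* + q j)  ≡⟨ cong₂ ℤ._+_ (zsum-*ˡ Nℤ (λ t → xs t j))
                                                                    (trans (zsum-cong (λ t → ℤP.*-comm (a t) (+ q j))) (zsum-*ˡ (+ q j) a)) ⟩
    Nℤ ℤ.* sumℤ (λ t → xs t j) ℤ.+ + q j ℤ.* sumℤ a             ≡⟨ cong₂ (λ u z → u ℤ.* z ℤ.+ + q j ℤ.* sumℤ a) N≡qⱼh (sym (Σxs≡w j)) ⟩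
    + q j ℤ.* + h ℤ.* (ℤ.- quot j) ℤ.+ + q j ℤ.* sumℤ a         ≡⟨ cong (λ z → + q j ℤ.* + h ℤ.* (ℤ.- quot j) ℤ.+ + q j ℤ.* z) Σa≡h ⟩
    + q j ℤ.* + h ℤ.* (ℤ.- quot j) ℤ.+ + q j ℤ.* + h            ≡⟨ factor (+ q j) (+ h) (quot j) ⟩
    + h ℤ.* rem j                                              ≡⟨ cong (+ h ℤ.*_) rem-self ⟩
    + h ℤ.* + 0                                                ≡⟨ ℤP.*-zeroʳ (+ h) ⟩
    + 0                                                        ∎
    where
    open ≡-Reasoning
    factor : ∀ a h F → a ℤ.* h ℤ.* (ℤ.- F) ℤ.+ a ℤ.* h ≡ h ℤ.* (a ℤ.- a ℤ.* F)
    factor a h F = ℤSolver.solve (a ∷ h ∷ F ∷ [])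

  gⱼ≡0 : ∀ t → g t j ≡ + 0
  gⱼ≡0 = nonneg-sum-zero (λ t → g t j) (λ t → g≥0 t j) (ℤP.≤-reflexive Σgⱼ≡0)

  nonzero-deficit : Σ (Fin m) λ t → a t ≢ + 0
  nonzero-deficit = znonzero-term a (λ Σa≡0 → ℤP.<-irrefl refl (subst (+ 0 ℤ.<_) (trans (sym Σa≡h) Σa≡0) (ℤ.+<+ 0<h)))

  t₀ : Fin m
  t₀ = proj₁ nonzero-deficit

  a₀≢0 : a t₀ ≢ + 0
  a₀≢0 = proj₂ nonzero-deficit

  -- From g_{t₀,j} = 0: a_{t₀} = h · (-x_{t₀,j}), and -x_{t₀,j} ≥ 1 as a_{t₀} > 0.
  a₀≡h*y : a t₀ ≡ + h ℤ.* (ℤ.- xs t₀ j)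
  a₀≡h*y = *-cancel-≡ (q j) (a t₀) (+ h ℤ.* (ℤ.- xs t₀ j)) 0<qⱼ
    (trans (isolate (+ q j) (+ h) (a t₀) (xs t₀ j))
    (trans (cong (ℤ._- + q j ℤ.* + h ℤ.* xs t₀ j)
                 (trans (cong (λ u → u ℤ.* xs t₀ j ℤ.+ a t₀ ℤ.* + q j) (sym N≡qⱼh)) (gⱼ≡0 t₀)))
           (factor (+ q j) (+ h) (xs t₀ j))))
    where
    isolate : ∀ q h a x → q ℤ.* a ≡ (q ℤ.* h ℤ.* x ℤ.+ a ℤ.* q) ℤ.- q ℤ.* h ℤ.* x
    isolate q h a x = ℤSolver.solve (q ∷ h ∷ a ∷ x ∷ [])
    factor : ∀ q h x → + 0 ℤ.- q ℤ.* h ℤ.* x ≡ q ℤ.* (h ℤ.* (ℤ.- x))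
    factor q h x = ℤSolver.solve (q ∷ h ∷ x ∷ [])

  a₀≡h : a t₀ ≡ + h
  a₀≡h = ℤP.≤-antisym (subst (a t₀ ℤ.≤_) Σa≡h (zterm≤sum a≥0 t₀)) h≤a₀
    where
    y≥0 : + 0 ℤ.≤ ℤ.- xs t₀ j
    y≥0 = *-cancel-nonneg h _ 0<h (subst (+ 0 ℤ.≤_) a₀≡h*y (a≥0 t₀))
    y≢0 : ℤ.- xs t₀ j ≢ + 0
    y≢0 y≡0 = a₀≢0 (trans a₀≡h*y (trans (cong (+ h ℤ.*_) y≡0) (ℤP.*-zeroʳ (+ h))))
    h≤a₀ : + h ℤ.≤ a t₀
    h≤a₀ = subst₂ ℤ._≤_ (ℤP.*-identityʳ (+ h)) (sym a₀≡h*y)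
      (ℤP.*-monoˡ-≤-nonNeg (+ h) (ℤP.i<j⇒suc[i]≤j (ℤP.≤∧≢⇒< y≥0 (λ 0≡y → y≢0 (sym 0≡y)))))

  -- With a_{t₀} = h the inequalities read h (q_j x_i + q_i) ≥ 0; since
  -- q_i < q_j (⌊q_i/q_j⌋ + 1) this forces x_i ≥ -⌊q_i/q_j⌋.
  x₀≥w : ∀ i → ℤ.- quot i ℤ.≤ xs t₀ i
  x₀≥w i = subst₂ ℤ._≤_ (ℤP.+-identityʳ (ℤ.- F)) (cancel x F) (ℤP.+-monoʳ-≤ (ℤ.- F) 0≤x+F)
    where
    x F : ℤ
    x = xs t₀ i
    F = quot i
    h[qⱼx+qᵢ]≥0 : + 0 ℤ.≤ + h ℤ.* (+ q j ℤ.* x ℤ.+ + q i)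
    h[qⱼx+qᵢ]≥0 = subst (+ 0 ℤ.≤_)
      (trans (cong₂ (λ u z → u ℤ.* x ℤ.+ z ℤ.* + q i) N≡qⱼh a₀≡h) (factor (+ q j) (+ h) x (+ q i)))
      (g≥0 t₀ i)
      where
      factor : ∀ a h x b → a ℤ.* h ℤ.* x ℤ.+ h ℤ.* b ≡ h ℤ.* (a ℤ.* x ℤ.+ b)
      factor a h x b = ℤSolver.solve (a ∷ h ∷ x ∷ b ∷ [])
    qⱼx+qᵢ≥0 : + 0 ℤ.≤ + q j ℤ.* x ℤ.+ + q i
    qⱼx+qᵢ≥0 = *-cancel-nonneg h _ 0<h h[qⱼx+qᵢ]≥0
    qⱼ[x+F+1]>0 : + 0 ℤ.< + q j ℤ.* (x ℤ.+ F ℤ.+ + 1)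
    qⱼ[x+F+1]>0 = ℤP.≤-<-trans qⱼx+qᵢ≥0 (subst₂ ℤ._<_ (regroup (+ q j) x F (+ q i)) (factor (+ q j) x F)
      (ℤP.+-monoʳ-< (+ q j ℤ.* (x ℤ.+ F)) (proj₂ (rem-bounds i))))
      where
      regroup : ∀ q x F Q → q ℤ.* (x ℤ.+ F) ℤ.+ (Q ℤ.- q ℤ.* F) ≡ q ℤ.* x ℤ.+ Q
      regroup q x F Q = ℤSolver.solve (q ∷ x ∷ F ∷ Q ∷ [])
      factor : ∀ q x F → q ℤ.* (x ℤ.+ F) ℤ.+ q ≡ q ℤ.* (x ℤ.+ F ℤ.+ + 1)
      factor q x F = ℤSolver.solve (q ∷ x ∷ F ∷ [])
    0≤x+F : + 0 ℤ.≤ x ℤ.+ F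
    0≤x+F = subst (+ 0 ℤ.≤_) (ℤP.pred-suc (x ℤ.+ F))
      (ℤP.i<j⇒i≤pred[j] (subst (+ 0 ℤ.<_) (ℤP.+-comm (x ℤ.+ F) (+ 1)) (*-cancel-pos (q j) _ 0<qⱼ qⱼ[x+F+1]>0)))
    cancel : ∀ x F → ℤ.- F ℤ.+ (x ℤ.+ F) ≡ x
    cancel x F = ℤSolver.solve (x ∷ F ∷ [])

  m≤1 : + m ℤ.≤ + 1
  m≤1 = subst (ℤ._≤ + 1) (sym m≡h-Σquot) h-Σquot≤1
    where
    -Σquot≤1-h : ℤ.- Σquot ℤ.≤ + 1 ℤ.- + h
    -Σquot≤1-h = subst₂ ℤ._≤_ (zsum-neg quot) (trans (double-neg (sumℤ (xs t₀))) (cong (ℤ._-_ (+ 1)) a₀≡h))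
      (zsum-mono x₀≥w)
      where
      double-neg : ∀ S → S ≡ + 1 ℤ.- (+ 1 ℤ.- S)
      double-neg S = ℤSolver.solve (S ∷ [])
    h-Σquot≤1 : + h ℤ.- Σquot ℤ.≤ + 1
    h-Σquot≤1 = subst (+ h ℤ.- Σquot ℤ.≤_) (cancel (+ h)) (ℤP.+-monoʳ-≤ (+ h) -Σquot≤1-h)
      where
      cancel : ∀ h → h ℤ.+ (+ 1 ℤ.- h) ≡ + 1
      cancel h = ℤSolver.solve (h ∷ [])

cofactor-positive : ∀ {Q} a h → + suc Q ≡ + a ℤ.* h → Σ ℕ λ h′ → h ≡ + suc h′
cofactor-positive a (+ suc h′) _ = h′ , refl
cofactor-positive a (+ zero) e with trans e (ℤP.*-zeroʳ (+ a))
... | ()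
cofactor-positive zero -[1+ b ] e with trans e (ℤP.*-zeroˡ -[1+ b ])
... | ()
cofactor-positive (suc a) -[1+ b ] ()

one-or-at-least-two : ∀ k → + 0 ℤ.< k → (k ≡ + 1) ⊎ (Σ ℕ λ m → (k ≡ + m) × (2 ℕ.≤ m))
one-or-at-least-two (+ zero) (ℤ.+<+ ())
one-or-at-least-two (+ suc zero) _ = inj₁ refl
one-or-at-least-two (+ suc (suc m)) _ = inj₂ (suc (suc m) , refl , ℕ.s≤s (ℕ.s≤s ℕ.z≤n))

-- Reflexivity gives N = q_j h with h > 0, hence 1 + R = q_j k for
-- k = h - Σ⌊q_i/q_j⌋ ≥ 1.  If k ≥ 2, the point w = -⌊q/q_j⌋ ∈ kΔ would be a
-- sum of k lattice points of Δ, which FloorPointDecomposition rules out.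
module ReflexiveIDP {n : ℕ} (q : Fin n → ℕ) (pos : Positive q)
                    (reflexive : Reflexive (Δvert q)) (idp : IDP (Δvert q)) (j : Fin n) where
  open Simplex q
  open Remainders q j (pos j)

  qⱼ∣N : Σ ℤ λ h → Nℤ ≡ + q j ℤ.* h
  qⱼ∣N = FacetVertex.reflexive⇒qⱼ∣N q pos j reflexive

  h-positive : Σ ℕ λ h′ → proj₁ qⱼ∣N ≡ + suc h′
  h-positive = cofactor-positive (q j) (proj₁ qⱼ∣N) (proj₂ qⱼ∣N)

  h : ℕ
  h = suc (proj₁ h-positive)

  N≡qⱼh : Nℤ ≡ + q j ℤ.* + h
  N≡qⱼh = trans (proj₂ qⱼ∣N) (cong (+ q j ℤ.*_) (proj₂ h-positive))

  k : ℤ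
  k = + h ℤ.- Σquot

  1+R≡qⱼk : + 1 ℤ.+ R ≡ + q j ℤ.* k
  1+R≡qⱼk = begin
    + 1 ℤ.+ R                                   ≡⟨ isolate (+ 1 ℤ.+ R) (+ q j ℤ.* Σquot) ⟩
    (+ 1 ℤ.+ R) ℤ.+ + q j ℤ.* Σquot ℤ.- + q j ℤ.* Σquot ≡⟨ cong (ℤ._- + q j ℤ.* Σquot) (trans (sym N≡1+R+qⱼΣquot) N≡qⱼh) ⟩
    + q j ℤ.* + h ℤ.- + q j ℤ.* Σquot           ≡⟨ factor (+ q j) (+ h) Σquot ⟩
    + q j ℤ.* k                                 ∎
    where
    open ≡-Reasoning
    isolate : ∀ a b → a ≡ a ℤ.+ b ℤ.- b
    isolate a b = ℤSolver.solve (a ∷ b ∷ [])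
    factor : ∀ a h G → a ℤ.* h ℤ.- a ℤ.* G ≡ a ℤ.* (h ℤ.- G)
    factor a h G = ℤSolver.solve (a ∷ h ∷ G ∷ [])

  0<k : + 0 ℤ.< k
  0<k = *-cancel-pos (q j) k (pos j) (subst (+ 0 ℤ.<_) 1+R≡qⱼk
    (ℤP.≤-<-trans (zsum-nonneg (exceptAt-nonneg j (λ i → proj₁ (rem-bounds i))))
                  (ℤP.suc[i]≤j⇒i<j ℤP.≤-refl)))

  not-at-least-two : ∀ m → k ≡ + m → 2 ℕ.≤ m → ⊥
  not-at-least-two m k≡m 2≤m = ℕP.<⇒≱ 2≤m (ℤP.drop‿+≤+ m≤1)
    where
    0<m : 0 ℕ.< m
    0<m = ℕP.<-trans (ℕ.s≤s ℕ.z≤n) 2≤m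
    1+R≡qⱼm : + 1 ℤ.+ R ≡ + q j ℤ.* + m
    1+R≡qⱼm = trans 1+R≡qⱼk (cong (+ q j ℤ.*_) k≡m)
    open FloorPoint q j (pos j) m 0<m 1+R≡qⱼm using (w; w∈mΔ)
    decomposition : Σ (Fin m → ZPoint n) λ xs → (∀ t → P (embed (xs t))) × (∀ i → w i ≡ sumℤ (λ t → xs t i))
    decomposition = idp m 0<m w w∈mΔ
    m≤1 : + m ℤ.≤ + 1
    m≤1 = FloorPointDecomposition.m≤1 q j (pos j) h (ℕ.s≤s ℕ.z≤n) N≡qⱼh m (sym k≡m)
      (proj₁ decomposition) (proj₁ (proj₂ decomposition)) (proj₂ (proj₂ decomposition))

  eqn-by-cases : (k ≡ + 1) ⊎ (Σ ℕ λ m → (k ≡ + m) × (2 ℕ.≤ m)) → Eqn q j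
  eqn-by-cases (inj₁ k≡1) = 1+R≡qⱼ⇒Eqn (trans 1+R≡qⱼk (trans (cong (+ q j ℤ.*_) k≡1) (ℤP.*-identityʳ (+ q j))))
  eqn-by-cases (inj₂ (m , k≡m , 2≤m)) = ⊥-elim (not-at-least-two m k≡m 2≤m)

  eqn : Eqn q j
  eqn = eqn-by-cases (one-or-at-least-two k 0<k)

-- If every equation holds then N = q_j D_j with
-- D_j = 1 + Σ_i ⌊q_i/q_j⌋, and the polar of Δ is the lattice simplex with
-- vertices U_0 = (1,…,1) and U_{j+1} = 1 - D_j e_j.  A point y of the polar has
-- weights d_0 = (1 + Σ q_i y_i)/N and d_{j+1} = (1 - y_j) q_j / N; conversely
-- every vertex U_t pairs with every vertex of Δ to at most 1.
module PolarOfSimplex {n : ℕ} (q : Fin n → ℕ) (pos : Positive q) (eqns : ∀ j → Eqn q j) where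
  open Simplex q

  D : Fin n → ℤ
  D j = + 1 ℤ.+ Remainders.Σquot q j (pos j)

  N≡qⱼDⱼ : ∀ j → Nℤ ≡ + q j ℤ.* D j
  N≡qⱼDⱼ j = Remainders.Eqn⇒N≡qⱼ* q j (pos j) (eqns j)

  qⱼDⱼ≡N : ∀ j → qℚ j Q.* ι (D j) ≡ Nℚ
  qⱼDⱼ≡N j = trans (sym (ι-homo-* (+ q j) (D j))) (cong ι (sym (N≡qⱼDⱼ j)))

  Dⱼ≥0 : ∀ j → 0ℚ Q.≤ ι (D j)
  Dⱼ≥0 j = ι-mono-≤ (ℤP.<⇒≤ (*-cancel-pos (q j) (D j) (pos j) (subst (+ 0 ℤ.<_) (N≡qⱼDⱼ j) (ℤ.+<+ (ℕ.s≤s ℕ.z≤n)))))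

  U : Fin (suc n) → ZPoint n
  U zero i = + 1
  U (suc j) i = + 1 ℤ.- D j ℤ.* unit j i

  Uℚ : Fin (suc n) → QPoint n
  Uℚ t = embed (U t)

  Uℚ-suc : ∀ j i → Uℚ (suc j) i ≡ 1ℚ Q.- ι (D j) Q.* δ j i
  Uℚ-suc j i = trans (ι-homo-+ (+ 1) (ℤ.- (D j ℤ.* unit j i)))
    (cong (1ℚ Q.+_) (trans (ι-homo-neg (D j ℤ.* unit j i)) (cong Q.-_ (ι-homo-* (D j) (unit j i)))))

  combination-coordU : ∀ (d : Fin (suc n) → ℚ) i →
    sumℚ (λ t → d t Q.* Uℚ t i) ≡ sumℚ d Q.- d (suc i) Q.* ι (D i)
  combination-coordU d i = begin
    d zero Q.* 1ℚ Q.+ sumℚ (λ j → d (suc j) Q.* Uℚ (suc j) i)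
      ≡⟨ cong₂ Q._+_ (QP.*-identityʳ (d zero)) (sum-cong (λ j → trans (cong (d (suc j) Q.*_) (Uℚ-suc j i)) (expand (d (suc j)) (ι (D j)) (δ j i)))) ⟩
    d zero Q.+ sumℚ (λ j → d (suc j) Q.+ Q.- ((d (suc j) Q.* ι (D j)) Q.* δ j i))
      ≡⟨ cong (d zero Q.+_) (trans (sum-+ (λ j → d (suc j)) (λ j → Q.- ((d (suc j) Q.* ι (D j)) Q.* δ j i)))
           (cong (sumℚ (λ j → d (suc j)) Q.+_) (trans (sum-neg (λ j → (d (suc j) Q.* ι (D j)) Q.* δ j i))
             (cong Q.-_ (sum-δ′ (λ j → d (suc j) Q.* ι (D j)) i))))) ⟩
    d zero Q.+ (sumℚ (λ j → d (suc j)) Q.+ Q.- (d (suc i) Q.* ι (D i)))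
      ≡⟨ sym (QP.+-assoc (d zero) _ _) ⟩
    sumℚ d Q.- d (suc i) Q.* ι (D i) ∎
    where
    open ≡-Reasoning
    open +-*-Solver
    expand : ∀ a b c → a Q.* (1ℚ Q.- b Q.* c) ≡ a Q.+ Q.- ((a Q.* b) Q.* c)
    expand = solve 3 (λ a b c → a :* (con 1ℚ :- b :* c) := a :+ :- ((a :* b) :* c)) refl

  1/N : Σ ℚ λ v → (v Q.* Nℚ ≡ 1ℚ) × (0ℚ Q.≤ v)
  1/N = inverse (suc Σq) (ℕ.s≤s ℕ.z≤n)

  v : ℚ
  v = proj₁ 1/N

  vN≡1 : v Q.* Nℚ ≡ 1ℚ
  vN≡1 = proj₁ (proj₂ 1/N)

  -- Barycentric weights of a point y of the polar with respect to the U_t;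
  -- they are nonnegative exactly because y pairs to at most 1 with the
  -- vertices of Δ.
  module PolarPoint (y : QPoint n) (y∈P° : Polar P y) where
    S : ℚ
    S = sumℚ (λ i → qℚ i Q.* y i)

    -S≤1 : Q.- S Q.≤ 1ℚ
    -S≤1 = subst (Q._≤ 1ℚ) (dot-V₀ y) (y∈P° (V zero) (vertex-in-hull V zero))

    yᵢ≤1 : ∀ i → y i Q.≤ 1ℚ
    yᵢ≤1 i = subst (Q._≤ 1ℚ) (dot-Vsuc i y) (y∈P° (V (suc i)) (vertex-in-hull V (suc i)))

    d : Fin (suc n) → ℚ
    d zero = (1ℚ Q.+ S) Q.* v
    d (suc j) = (1ℚ Q.- y j) Q.* qℚ j Q.* v

    d≥0 : ∀ t → 0ℚ Q.≤ d t
    d≥0 zero = *-nonneg (subst (0ℚ Q.≤_) (double-neg S) (≤⇒0≤- -S≤1)) (proj₂ (proj₂ 1/N))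
      where
      open +-*-Solver
      double-neg : ∀ S → 1ℚ Q.- Q.- S ≡ 1ℚ Q.+ S
      double-neg = solve 1 (λ S → con 1ℚ :- :- S := con 1ℚ :+ S) refl
    d≥0 (suc j) = *-nonneg (*-nonneg (≤⇒0≤- (yᵢ≤1 j)) (ι-nonneg (q j))) (proj₂ (proj₂ 1/N))

    Σdsuc : sumℚ (λ j → d (suc j)) ≡ ι (+ Σq) Q.* v Q.- S Q.* v
    Σdsuc = begin
      sumℚ (λ j → (1ℚ Q.- y j) Q.* qℚ j Q.* v)                           ≡⟨ sum-cong (λ j → expand (y j) (qℚ j) v) ⟩
      sumℚ (λ j → qℚ j Q.* v Q.+ Q.- (qℚ j Q.* y j Q.* v))               ≡⟨ sum-+ (λ j → qℚ j Q.* v) (λ j → Q.- (qℚ j Q.* y j Q.* v)) ⟩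
      sumℚ (λ j → qℚ j Q.* v) Q.+ sumℚ (λ j → Q.- (qℚ j Q.* y j Q.* v))  ≡⟨ cong₂ Q._+_ (trans (sum-*ʳ v qℚ) (cong (Q._* v) Σqℚ))
                                                                             (trans (sum-neg (λ j → qℚ j Q.* y j Q.* v)) (cong Q.-_ (sum-*ʳ v (λ j → qℚ j Q.* y j)))) ⟩
      ι (+ Σq) Q.* v Q.- S Q.* v                                         ∎
      where
      open ≡-Reasoning
      open +-*-Solver
      expand : ∀ y q v → (1ℚ Q.- y) Q.* q Q.* v ≡ q Q.* v Q.+ Q.- (q Q.* y Q.* v)
      expand = solve 3 (λ y q v → (con 1ℚ :- y) :* q :* v := q :* v :+ :- (q :* y :* v)) refl

    Σd≡1 : sumℚ d ≡ 1ℚ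
    Σd≡1 = begin
      (1ℚ Q.+ S) Q.* v Q.+ sumℚ (λ j → d (suc j))          ≡⟨ cong ((1ℚ Q.+ S) Q.* v Q.+_) Σdsuc ⟩
      (1ℚ Q.+ S) Q.* v Q.+ (ι (+ Σq) Q.* v Q.- S Q.* v)    ≡⟨ collect S (ι (+ Σq)) v ⟩
      v Q.* (1ℚ Q.+ ι (+ Σq))                              ≡⟨ cong (v Q.*_) (sym Nℚ-split) ⟩
      v Q.* Nℚ                                             ≡⟨ vN≡1 ⟩
      1ℚ                                                   ∎
      where
      open ≡-Reasoning
      open +-*-Solver
      collect : ∀ S Q v → (1ℚ Q.+ S) Q.* v Q.+ (Q Q.* v Q.- S Q.* v) ≡ v Q.* (1ℚ Q.+ Q)
      collect = solve 3 (λ S Q v → (con 1ℚ :+ S) :* v :+ (Q :* v :- S :* v) := v :* (con 1ℚ :+ Q)) refl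

    y-coord : ∀ i → y i ≡ sumℚ (λ t → d t Q.* Uℚ t i)
    y-coord i = sym (begin
      sumℚ (λ t → d t Q.* Uℚ t i)                      ≡⟨ combination-coordU d i ⟩
      sumℚ d Q.- d (suc i) Q.* ι (D i)                 ≡⟨ cong₂ Q._-_ Σd≡1 (regroup (y i) (qℚ i) v (ι (D i))) ⟩
      1ℚ Q.- (1ℚ Q.- y i) Q.* (v Q.* (qℚ i Q.* ι (D i))) ≡⟨ cong (λ z → 1ℚ Q.- (1ℚ Q.- y i) Q.* (v Q.* z)) (qⱼDⱼ≡N i) ⟩
      1ℚ Q.- (1ℚ Q.- y i) Q.* (v Q.* Nℚ)               ≡⟨ cong (λ z → 1ℚ Q.- (1ℚ Q.- y i) Q.* z) vN≡1 ⟩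
      1ℚ Q.- (1ℚ Q.- y i) Q.* 1ℚ                       ≡⟨ simplify (y i) ⟩
      y i                                              ∎)
      where
      open ≡-Reasoning
      open +-*-Solver
      regroup : ∀ y q v D → (1ℚ Q.- y) Q.* q Q.* v Q.* D ≡ (1ℚ Q.- y) Q.* (v Q.* (q Q.* D))
      regroup = solve 4 (λ y q v D → (con 1ℚ :- y) :* q :* v :* D := (con 1ℚ :- y) :* (v :* (q :* D))) refl
      simplify : ∀ y → 1ℚ Q.- (1ℚ Q.- y) Q.* 1ℚ ≡ y
      simplify = solve 1 (λ y → con 1ℚ :- (con 1ℚ :- y) :* con 1ℚ := y) refl

  polar⇒hull : ∀ y → Polar P y → InConvHull Uℚ y
  polar⇒hull y y∈P° = d , d≥0 , Σd≡1 , y-coord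
    where open PolarPoint y y∈P°

  module HullPoint (y : QPoint n) (d : Fin (suc n) → ℚ) (Σd≡1 : sumℚ d ≡ 1ℚ)
                   (y≡ : ∀ i → y i ≡ sumℚ (λ t → d t Q.* Uℚ t i)) where
    yᵢ≡ : ∀ i → y i ≡ 1ℚ Q.- d (suc i) Q.* ι (D i)
    yᵢ≡ i = trans (y≡ i) (trans (combination-coordU d i) (cong (Q._- d (suc i) Q.* ι (D i)) Σd≡1))

    Σdsuc : sumℚ (λ j → d (suc j)) ≡ 1ℚ Q.- d zero
    Σdsuc = trans (isolate (d zero) (sumℚ (λ j → d (suc j)))) (cong (Q._- d zero) Σd≡1)
      where
      open +-*-Solver
      isolate : ∀ a b → b ≡ (a Q.+ b) Q.- a
      isolate = solve 2 (λ a b → b := (a :+ b) :- a) refl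

    Σ-weighted : sumℚ (λ i → Q.- (d (suc i) Q.* (qℚ i Q.* ι (D i)))) ≡ Q.- (sumℚ (λ i → d (suc i)) Q.* Nℚ)
    Σ-weighted = trans (sum-neg (λ i → d (suc i) Q.* (qℚ i Q.* ι (D i))))
      (cong Q.-_ (trans (sum-cong (λ i → cong (d (suc i) Q.*_) (qⱼDⱼ≡N i))) (sum-*ʳ Nℚ (λ i → d (suc i)))))

    pairing-V₀ : dot (V zero) y ≡ 1ℚ Q.- d zero Q.* Nℚ
    pairing-V₀ = begin
      dot (V zero) y                                                        ≡⟨ dot-V₀ y ⟩
      Q.- sumℚ (λ i → qℚ i Q.* y i)                                          ≡⟨ cong Q.-_ (sum-cong (λ i → trans (cong (qℚ i Q.*_) (yᵢ≡ i)) (expand (qℚ i) (d (suc i)) (ι (D i))))) ⟩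
      Q.- sumℚ (λ i → qℚ i Q.+ Q.- (d (suc i) Q.* (qℚ i Q.* ι (D i))))       ≡⟨ cong Q.-_ (sum-+ qℚ (λ i → Q.- (d (suc i) Q.* (qℚ i Q.* ι (D i))))) ⟩
      Q.- (sumℚ qℚ Q.+ sumℚ (λ i → Q.- (d (suc i) Q.* (qℚ i Q.* ι (D i)))))   ≡⟨ cong (λ z → Q.- (sumℚ qℚ Q.+ z)) Σ-weighted ⟩
      Q.- (sumℚ qℚ Q.+ Q.- (sumℚ (λ i → d (suc i)) Q.* Nℚ))                  ≡⟨ cong₂ (λ a b → Q.- (a Q.+ Q.- (b Q.* Nℚ))) Σqℚ Σdsuc ⟩
      Q.- (ι (+ Σq) Q.+ Q.- ((1ℚ Q.- d zero) Q.* Nℚ))                        ≡⟨ cong (λ z → Q.- (ι (+ Σq) Q.+ Q.- ((1ℚ Q.- d zero) Q.* z))) Nℚ-split ⟩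
      Q.- (ι (+ Σq) Q.+ Q.- ((1ℚ Q.- d zero) Q.* (1ℚ Q.+ ι (+ Σq))))         ≡⟨ simplify (ι (+ Σq)) (d zero) ⟩
      1ℚ Q.- d zero Q.* (1ℚ Q.+ ι (+ Σq))                                   ≡⟨ cong (λ z → 1ℚ Q.- d zero Q.* z) (sym Nℚ-split) ⟩
      1ℚ Q.- d zero Q.* Nℚ                                                  ∎
      where
      open ≡-Reasoning
      open +-*-Solver
      expand : ∀ q d D → q Q.* (1ℚ Q.- d Q.* D) ≡ q Q.+ Q.- (d Q.* (q Q.* D))
      expand = solve 3 (λ q d D → q :* (con 1ℚ :- d :* D) := q :+ :- (d :* (q :* D))) refl
      simplify : ∀ Q d → Q.- (Q Q.+ Q.- ((1ℚ Q.- d) Q.* (1ℚ Q.+ Q))) ≡ 1ℚ Q.- d Q.* (1ℚ Q.+ Q)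
      simplify = solve 2 (λ Q d → :- (Q :+ :- ((con 1ℚ :- d) :* (con 1ℚ :+ Q))) := con 1ℚ :- d :* (con 1ℚ :+ Q)) refl

  hull⇒polar : ∀ y → InConvHull Uℚ y → Polar P y
  hull⇒polar y (d , d≥0 , Σd≡1 , y≡) x x∈P = hull-bound V x y bound x∈P
    where
    open HullPoint y d Σd≡1 y≡
    bound : ∀ t → dot (V t) y Q.≤ 1ℚ
    bound zero = subst (Q._≤ 1ℚ) (sym pairing-V₀) (-≤-self 1ℚ _ (*-nonneg (d≥0 zero) (ι-nonneg (suc Σq))))
    bound (suc k) = subst (Q._≤ 1ℚ) (sym (trans (dot-Vsuc k y) (yᵢ≡ k)))
      (-≤-self 1ℚ _ (*-nonneg (d≥0 (suc k)) (Dⱼ≥0 k)))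

  polar-is-lattice : IsLatticePolytope (Polar P)
  polar-is-lattice = suc n , U , λ y → mk⇔ (polar⇒hull y) (hull⇒polar y)

-- 0 is an interior point of Δ: with ε = 1/(2N), every y with |y_i| ≤ ε has
-- weight c_0 = 2ε(1 - Σ y) ≥ ε, since Σ y ≤ nε ≤ Nε = 1/2, and then
-- c_{i+1} = y_i + c_0 q_i ≥ -ε + ε = 0.
module Interior {n : ℕ} (q : Fin n → ℕ) (pos : Positive q) where
  open Simplex q

  1/2N : Σ ℚ λ ε → (ε Q.* ι (+ (suc Σq ℕ.+ suc Σq)) ≡ 1ℚ) × (0ℚ Q.≤ ε)
  1/2N = inverse (suc Σq ℕ.+ suc Σq) (ℕ.s≤s ℕ.z≤n)

  ε : ℚ
  ε = proj₁ 1/2N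

  ε≥0 : 0ℚ Q.≤ ε
  ε≥0 = proj₂ (proj₂ 1/2N)

  2Nε≡1 : Nℚ Q.* ε Q.+ Nℚ Q.* ε ≡ 1ℚ
  2Nε≡1 = trans (factor Nℚ ε) (trans (cong (ε Q.*_) (sym (ι-homo-+ Nℤ Nℤ))) (proj₁ (proj₂ 1/2N)))
    where
    open +-*-Solver
    factor : ∀ N e → N Q.* e Q.+ N Q.* e ≡ e Q.* (N Q.+ N)
    factor = solve 2 (λ N e → N :* e :+ N :* e := e :* (N :+ N)) refl

  instance
    ε-positive : Q.Positive ε
    ε-positive = nonneg-nonzero⇒positive ε≥0 (λ ε≡0 → QP.<-irrefl refl (subst (0ℚ Q.<_)
      (trans (sym 2Nε≡1) (trans (cong (λ e → Nℚ Q.* e Q.+ Nℚ Q.* e) ε≡0) (cong₂ Q._+_ (QP.*-zeroʳ Nℚ) (QP.*-zeroʳ Nℚ))))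
      (QP.positive⁻¹ 1ℚ)))

  1-Nε≡Nε : 1ℚ Q.- Nℚ Q.* ε ≡ Nℚ Q.* ε
  1-Nε≡Nε = trans (cong (Q._- Nℚ Q.* ε) (sym 2Nε≡1)) (cancel (Nℚ Q.* ε))
    where
    open +-*-Solver
    cancel : ∀ a → a Q.+ a Q.- a ≡ a
    cancel = solve 1 (λ a → a :+ a :- a := a) refl

  module BoxPoint (y : QPoint n) (y-small : ∀ i → Q.∣ y i ∣ Q.≤ ε) where
    S : ℚ
    S = sumℚ y

    S≤Nε : S Q.≤ Nℚ Q.* ε
    S≤Nε = QP.≤-trans (subst (S Q.≤_) (sum-const n ε) (sum-mono (λ i → proj₂ (∣∣≤⇒bounds (y i) ε (y-small i)))))
      (QP.*-monoʳ-≤-nonNeg ε {{Q.nonNegative ε≥0}}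
        (ι-mono-≤ (ℤ.+≤+ (ℕP.≤-trans (sumℕ-positive q pos) (ℕP.n≤1+n _)))))

    c₀ : ℚ
    c₀ = (1ℚ Q.- S) Q.* (ε Q.+ ε)

    c : Fin (suc n) → ℚ
    c zero = c₀
    c (suc i) = y i Q.+ c₀ Q.* qℚ i

    ε≤c₀ : ε Q.≤ c₀
    ε≤c₀ = subst (Q._≤ c₀) (trans (regroup (Nℚ Q.* ε) ε) (trans (cong (ε Q.*_) 2Nε≡1) (QP.*-identityʳ ε)))
      (QP.*-monoʳ-≤-nonNeg (ε Q.+ ε) {{Q.nonNegative (QP.+-mono-≤ ε≥0 ε≥0)}}
        (subst (Q._≤ 1ℚ Q.- S) 1-Nε≡Nε (QP.+-monoʳ-≤ 1ℚ (QP.neg-antimono-≤ S≤Nε))))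
      where
      open +-*-Solver
      regroup : ∀ a e → a Q.* (e Q.+ e) ≡ e Q.* (a Q.+ a)
      regroup = solve 2 (λ a e → a :* (e :+ e) := e :* (a :+ a)) refl

    c≥0 : ∀ t → 0ℚ Q.≤ c t
    c≥0 zero = QP.≤-trans ε≥0 ε≤c₀
    c≥0 (suc i) = subst (Q._≤ y i Q.+ c₀ Q.* qℚ i) (QP.+-inverseˡ ε)
      (QP.+-mono-≤ (proj₁ (∣∣≤⇒bounds (y i) ε (y-small i)))
        (QP.≤-trans ε≤c₀ (subst (Q._≤ c₀ Q.* qℚ i) (QP.*-identityʳ c₀)
          (QP.*-monoˡ-≤-nonNeg c₀ {{Q.nonNegative (c≥0 zero)}} (ι-mono-≤ (ℤ.+≤+ (pos i)))))))

    c₀N≡1-S : c₀ Q.* Nℚ ≡ 1ℚ Q.- S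
    c₀N≡1-S = trans (regroup (1ℚ Q.- S) ε Nℚ) (trans (cong ((1ℚ Q.- S) Q.*_) 2Nε≡1) (QP.*-identityʳ _))
      where
      open +-*-Solver
      regroup : ∀ a e N → a Q.* (e Q.+ e) Q.* N ≡ a Q.* (N Q.* e Q.+ N Q.* e)
      regroup = solve 3 (λ a e N → a :* (e :+ e) :* N := a :* (N :* e :+ N :* e)) refl

    Σc≡1 : sumℚ c ≡ 1ℚ
    Σc≡1 = begin
      c₀ Q.+ sumℚ (λ i → y i Q.+ c₀ Q.* qℚ i)  ≡⟨ cong (c₀ Q.+_) (trans (sum-+ y (λ i → c₀ Q.* qℚ i))
                                                  (cong (S Q.+_) (trans (sum-*ˡ c₀ qℚ) (cong (c₀ Q.*_) Σqℚ)))) ⟩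
      c₀ Q.+ (S Q.+ c₀ Q.* ι (+ Σq))           ≡⟨ regroup c₀ S (ι (+ Σq)) ⟩
      c₀ Q.* (1ℚ Q.+ ι (+ Σq)) Q.+ S           ≡⟨ cong (λ z → c₀ Q.* z Q.+ S) (sym Nℚ-split) ⟩
      c₀ Q.* Nℚ Q.+ S                          ≡⟨ cong (Q._+ S) c₀N≡1-S ⟩
      1ℚ Q.- S Q.+ S                           ≡⟨ cancel S ⟩
      1ℚ                                       ∎
      where
      open ≡-Reasoning
      open +-*-Solver
      regroup : ∀ c S Q → c Q.+ (S Q.+ c Q.* Q) ≡ c Q.* (1ℚ Q.+ Q) Q.+ S
      regroup = solve 3 (λ c S Q → c :+ (S :+ c :* Q) := c :* (con 1ℚ :+ Q) :+ S) refl
      cancel : ∀ S → 1ℚ Q.- S Q.+ S ≡ 1ℚ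
      cancel = solve 1 (λ S → con 1ℚ :- S :+ S := con 1ℚ) refl

    y-coord : ∀ i → y i ≡ sumℚ (λ t → c t Q.* V t i)
    y-coord i = sym (trans (combination-coord c i) (cancel (y i) (c₀ Q.* qℚ i)))
      where
      open +-*-Solver
      cancel : ∀ a b → a Q.+ b Q.- b ≡ a
      cancel = solve 2 (λ a b → a :+ b :- b := a) refl

  box⊆Δ : ∀ y → (∀ i → Q.∣ y i ∣ Q.≤ ε) → P y
  box⊆Δ y y-small = c , c≥0 , Σc≡1 , y-coord
    where open BoxPoint y y-small

  zero-interior : ZeroInInterior P
  zero-interior = ε , QP.positive⁻¹ ε , box⊆Δ

Δ-is-lattice : ∀ {n} (q : Fin n → ℕ) → IsLatticePolytope (Simplex.P q)
Δ-is-lattice {n} q = suc n , Δvert q , λ y → mk⇔ (λ y∈Δ → y∈Δ) (λ y∈Δ → y∈Δ)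

equations⇒reflexive : ∀ {n} (q : Fin n → ℕ) → Positive q → (∀ j → Eqn q j) → Reflexive (Δvert q)
equations⇒reflexive q pos eqns =
  Δ-is-lattice q , Interior.zero-interior q pos , PolarOfSimplex.polar-is-lattice q pos eqns

-- The point w = (-1,-1,-8,-10,-10) lies in 2Δ, but w = x + x' with x, x' lattice
-- points of Δ is impossible: the deficits satisfy a + a' = 2 - Σ w = 32, and
-- the inequalities at coordinate 3 add up to 0, so 60 x_3 + 15 a = 0, i.e.
-- a = 4s with s = -x_3 ∈ [0, 8].  If s = 0 (or s = 8) one summand has deficit
-- 32 and the other is ≤ 0 coordinatewise with coordinate sum 1; otherwise the
-- first coordinate gives 0 ≤ 15 x_1 + 2s ≤ 1 with 1 ≤ s ≤ 7.
module Example where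
  open Simplex qEx

  equations : ∀ j → Eqn qEx j
  equations zero = refl
  equations (suc zero) = refl
  equations (suc (suc zero)) = refl
  equations (suc (suc (suc zero))) = refl
  equations (suc (suc (suc (suc zero)))) = refl

  w : ZPoint 5
  w zero = ℤ.- + 1
  w (suc zero) = ℤ.- + 1
  w (suc (suc zero)) = ℤ.- + 8
  w (suc (suc (suc zero))) = ℤ.- + 10
  w (suc (suc (suc (suc zero)))) = ℤ.- + 10

  -- w/2 = (4/15)(-q) + (1/30) e_1 + (1/30) e_2 + (1/3) e_4 + (1/3) e_5.
  weights : Fin 6 → ℚ
  weights zero = + 4 Q./ 15
  weights (suc zero) = + 1 Q./ 30
  weights (suc (suc zero)) = + 1 Q./ 30
  weights (suc (suc (suc zero))) = 0ℚ
  weights (suc (suc (suc (suc zero)))) = + 1 Q./ 3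
  weights (suc (suc (suc (suc (suc zero))))) = + 1 Q./ 3

  half-w : QPoint 5
  half-w i = ι (w i) Q.* (+ 1 Q./ 2)

  weights≥0 : ∀ t → 0ℚ Q.≤ weights t
  weights≥0 t = toWitness (nonneg-by-computation t)
    where
    nonneg-by-computation : ∀ t → True (0ℚ QP.≤? weights t)
    nonneg-by-computation zero = _
    nonneg-by-computation (suc zero) = _
    nonneg-by-computation (suc (suc zero)) = _
    nonneg-by-computation (suc (suc (suc zero))) = _
    nonneg-by-computation (suc (suc (suc (suc zero)))) = _
    nonneg-by-computation (suc (suc (suc (suc (suc zero))))) = _

  half-w-coord : ∀ i → half-w i ≡ sumℚ (λ t → weights t Q.* V t i)
  half-w-coord zero = refl
  half-w-coord (suc zero) = refl
  half-w-coord (suc (suc zero)) = refl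
  half-w-coord (suc (suc (suc zero))) = refl
  half-w-coord (suc (suc (suc (suc zero)))) = refl

  w≡2·half-w : ∀ i → embed w i ≡ (+ 2 Q./ 1) Q.* half-w i
  w≡2·half-w zero = refl
  w≡2·half-w (suc zero) = refl
  w≡2·half-w (suc (suc zero)) = refl
  w≡2·half-w (suc (suc (suc zero))) = refl
  w≡2·half-w (suc (suc (suc (suc zero)))) = refl

  w∈2Δ : InDilate 2 V (embed w)
  w∈2Δ = half-w , (weights , weights≥0 , refl , half-w-coord) , w≡2·half-w

  no-small-solution : ∀ u s → + 1 ℤ.≤ s → s ℤ.≤ + 7 →
    + 0 ℤ.≤ + 15 ℤ.* u ℤ.+ + 2 ℤ.* s → + 15 ℤ.* u ℤ.+ + 2 ℤ.* s ℤ.≤ + 1 → ⊥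
  no-small-solution u s 1≤s s≤7 lower upper =
    ℤP.<-irrefl refl (ℤP.≤-<-trans lower (ℤP.≤-<-trans too-small (ℤ.-<+ {0} {0})))
    where
    15u+2≤1 : + 15 ℤ.* u ℤ.+ + 2 ℤ.≤ + 1
    15u+2≤1 = ℤP.≤-trans (ℤP.+-monoʳ-≤ (+ 15 ℤ.* u) (ℤP.*-monoˡ-≤-nonNeg (+ 2) 1≤s)) upper
    u<0 : u ℤ.< + 0
    u<0 = *-cancel-< 15 u (+ 0) (ℕ.s≤s ℕ.z≤n) (ℤP.suc[i]≤j⇒i<j
      (subst (ℤ._≤ + 0) (shift (+ 15 ℤ.* u)) (ℤP.+-monoʳ-≤ (ℤ.- + 1) 15u+2≤1)))
      where
      shift : ∀ z → ℤ.- + 1 ℤ.+ (z ℤ.+ + 2) ≡ + 1 ℤ.+ z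
      shift z = ℤSolver.solve (z ∷ [])
    too-small : + 15 ℤ.* u ℤ.+ + 2 ℤ.* s ℤ.≤ ℤ.- + 1
    too-small = ℤP.+-mono-≤ (ℤP.*-monoˡ-≤-nonNeg (+ 15) (ℤP.i<j⇒i≤pred[j] u<0)) (ℤP.*-monoˡ-≤-nonNeg (+ 2) s≤7)

  no-deficit-32 : (x x' : ZPoint 5) → (∀ i → w i ≡ x i ℤ.+ x' i) → deficit x ≡ + 0 →
    (∀ i → + 0 ℤ.≤ Nℤ ℤ.* x' i ℤ.+ + 32 ℤ.* + qEx i) → ⊥
  no-deficit-32 x x' w≡ a≡0 bounds′ =
    ℤP.<-irrefl refl (ℤP.<-≤-trans (ℤ.+<+ (ℕ.s≤s ℕ.z≤n)) (subst (ℤ._≤ + 0) Σx≡1 Σx≤0))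
    where
    B : Fin 5 → ℤ
    B i = + 60 ℤ.* w i ℤ.+ + 32 ℤ.* + qEx i
    B<60 : ∀ i → B i ℤ.< + 60 ℤ.* + 1
    B<60 zero = ℤ.+<+ (toWitness {a? = 4 ℕ.<? 60} _)
    B<60 (suc zero) = ℤ.+<+ (toWitness {a? = 4 ℕ.<? 60} _)
    B<60 (suc (suc zero)) = ℤ.+<+ (toWitness {a? = 0 ℕ.<? 60} _)
    B<60 (suc (suc (suc zero))) = ℤ.+<+ (toWitness {a? = 40 ℕ.<? 60} _)
    B<60 (suc (suc (suc (suc zero)))) = ℤ.+<+ (toWitness {a? = 40 ℕ.<? 60} _)
    xᵢ≤0 : ∀ i → x i ℤ.≤ + 0
    xᵢ≤0 i = ℤP.i<j⇒i≤pred[j] (*-cancel-< 60 (x i) (+ 1) (ℕ.s≤s ℕ.z≤n) (ℤP.≤-<-trans 60x≤B (B<60 i)))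
      where
      regroup : ∀ a b c → + 60 ℤ.* a ℤ.+ (+ 60 ℤ.* b ℤ.+ c) ≡ + 60 ℤ.* (a ℤ.+ b) ℤ.+ c
      regroup a b c = ℤSolver.solve (a ∷ b ∷ c ∷ [])
      60x≤B : + 60 ℤ.* x i ℤ.≤ B i
      60x≤B = subst₂ ℤ._≤_ (ℤP.+-identityʳ (+ 60 ℤ.* x i))
        (trans (regroup (x i) (x' i) (+ 32 ℤ.* + qEx i)) (cong (λ z → + 60 ℤ.* z ℤ.+ + 32 ℤ.* + qEx i) (sym (w≡ i))))
        (ℤP.+-monoʳ-≤ (+ 60 ℤ.* x i) (bounds′ i))
    Σx≤0 : sumℤ x ℤ.≤ + 0
    Σx≤0 = subst (sumℤ x ℤ.≤_) (zsum-0 {5}) (zsum-mono xᵢ≤0)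
    Σx≡1 : sumℤ x ≡ + 1
    Σx≡1 = trans (double-neg (sumℤ x)) (cong (ℤ._-_ (+ 1)) a≡0)
      where
      double-neg : ∀ S → S ≡ + 1 ℤ.- (+ 1 ℤ.- S)
      double-neg S = ℤSolver.solve (S ∷ [])

  module TwoSummands (x x' : ZPoint 5) (x∈Δ : P (embed x)) (x'∈Δ : P (embed x'))
                     (w≡ : ∀ i → w i ≡ x i ℤ.+ x' i) where
    a a' : ℤ
    a = deficit x
    a' = deficit x'

    g g' : Fin 5 → ℤ
    g i = Nℤ ℤ.* x i ℤ.+ a ℤ.* + qEx i
    g' i = Nℤ ℤ.* x' i ℤ.+ a' ℤ.* + qEx i

    g≥0 : ∀ i → + 0 ℤ.≤ g i
    g≥0 = proj₂ (lattice-point-bounds x x∈Δ)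

    g'≥0 : ∀ i → + 0 ℤ.≤ g' i
    g'≥0 = proj₂ (lattice-point-bounds x' x'∈Δ)

    a+a'≡32 : a ℤ.+ a' ≡ + 32
    a+a'≡32 = trans (regroup (sumℤ x) (sumℤ x'))
      (cong (ℤ._-_ (+ 2)) (trans (sym (zsum-+ x x')) (zsum-cong (λ i → sym (w≡ i)))))
      where
      regroup : ∀ S S' → (+ 1 ℤ.- S) ℤ.+ (+ 1 ℤ.- S') ≡ + 2 ℤ.- (S ℤ.+ S')
      regroup S S' = ℤSolver.solve (S ∷ S' ∷ [])

    g+g' : ∀ i → g i ℤ.+ g' i ≡ + 60 ℤ.* w i ℤ.+ + qEx i ℤ.* + 32
    g+g' i = trans (regroup (x i) (x' i) a a' (+ qEx i))
      (cong₂ (λ u z → + 60 ℤ.* u ℤ.+ + qEx i ℤ.* z) (sym (w≡ i)) a+a'≡32)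
      where
      regroup : ∀ p p' a a' Q → (+ 60 ℤ.* p ℤ.+ a ℤ.* Q) ℤ.+ (+ 60 ℤ.* p' ℤ.+ a' ℤ.* Q) ≡
                                + 60 ℤ.* (p ℤ.+ p') ℤ.+ Q ℤ.* (a ℤ.+ a')
      regroup p p' a a' Q = ℤSolver.solve (p ∷ p' ∷ a ∷ a' ∷ Q ∷ [])

    ≤-sum : ∀ i → g i ℤ.≤ g i ℤ.+ g' i
    ≤-sum i = subst (ℤ._≤ g i ℤ.+ g' i) (ℤP.+-identityʳ (g i)) (ℤP.+-monoʳ-≤ (g i) (g'≥0 i))

    -- Coordinate 3 (q_3 = 15): the two inequalities add up to 0.
    i₃ : Fin 5
    i₃ = suc (suc zero)

    s : ℤ
    s = ℤ.- x i₃

    a≡4s : a ≡ + 4 ℤ.* s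
    a≡4s = trans (isolate a (x i₃)) (trans (cong (ℤ._+ + 4 ℤ.* s) 4x+a≡0) (ℤP.+-identityˡ (+ 4 ℤ.* s)))
      where
      g₃≡0 : g i₃ ≡ + 0
      g₃≡0 = ℤP.≤-antisym (subst (g i₃ ℤ.≤_) (g+g' i₃) (≤-sum i₃)) (g≥0 i₃)
      4x+a≡0 : + 4 ℤ.* x i₃ ℤ.+ a ≡ + 0
      4x+a≡0 = *-cancel-≡ 15 (+ 4 ℤ.* x i₃ ℤ.+ a) (+ 0) (ℕ.s≤s ℕ.z≤n) (trans (scale (x i₃) a) g₃≡0)
        where
        scale : ∀ p a → + 15 ℤ.* (+ 4 ℤ.* p ℤ.+ a) ≡ + 60 ℤ.* p ℤ.+ a ℤ.* + 15
        scale p a = ℤSolver.solve (p ∷ a ∷ [])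
      isolate : ∀ a p → a ≡ (+ 4 ℤ.* p ℤ.+ a) ℤ.+ + 4 ℤ.* (ℤ.- p)
      isolate a p = ℤSolver.solve (a ∷ p ∷ [])

    s≥0 : + 0 ℤ.≤ s
    s≥0 = *-cancel-nonneg 4 s (ℕ.s≤s ℕ.z≤n) (subst (+ 0 ℤ.≤_) a≡4s (proj₁ (lattice-point-bounds x x∈Δ)))

    s≤8 : s ℤ.≤ + 8
    s≤8 = *-cancel-≤ 4 s (+ 8) (ℕ.s≤s ℕ.z≤n) (subst₂ ℤ._≤_ a≡4s a+a'≡32
      (subst (ℤ._≤ a ℤ.+ a') (ℤP.+-identityʳ a) (ℤP.+-monoʳ-≤ a (proj₁ (lattice-point-bounds x' x'∈Δ)))))

    a'≡32-a : a' ≡ + 32 ℤ.- a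
    a'≡32-a = trans (isolate a a') (cong (ℤ._- a) a+a'≡32)
      where
      isolate : ∀ a a' → a' ≡ (a ℤ.+ a') ℤ.- a
      isolate a a' = ℤSolver.solve (a ∷ a' ∷ [])

    -- Coordinate 1 (q_1 = 2): g_1 = 4 (15 x_1 + 2 s) and g_1 + g'_1 = 4.
    t : ℤ
    t = + 15 ℤ.* x zero ℤ.+ + 2 ℤ.* s

    g₁≡4t : g zero ≡ + 4 ℤ.* t
    g₁≡4t = trans (cong (λ z → + 60 ℤ.* x zero ℤ.+ z ℤ.* + 2) a≡4s) (factor (x zero) s)
      where
      factor : ∀ u s → + 60 ℤ.* u ℤ.+ (+ 4 ℤ.* s) ℤ.* + 2 ≡ + 4 ℤ.* (+ 15 ℤ.* u ℤ.+ + 2 ℤ.* s)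
      factor u s = ℤSolver.solve (u ∷ s ∷ [])

    t≥0 : + 0 ℤ.≤ t
    t≥0 = *-cancel-nonneg 4 t (ℕ.s≤s ℕ.z≤n) (subst (+ 0 ℤ.≤_) g₁≡4t (g≥0 zero))

    t≤1 : t ℤ.≤ + 1
    t≤1 = *-cancel-≤ 4 t (+ 1) (ℕ.s≤s ℕ.z≤n) (subst₂ ℤ._≤_ g₁≡4t (g+g' zero) (≤-sum zero))

    by-cases : Dec (s ≡ + 0) → Dec (s ≡ + 8) → ⊥
    by-cases (yes s≡0) _ = no-deficit-32 x x' w≡ a≡0
      (λ i → subst (λ z → + 0 ℤ.≤ Nℤ ℤ.* x' i ℤ.+ z ℤ.* + qEx i) (trans a'≡32-a (cong (ℤ._-_ (+ 32)) a≡0)) (g'≥0 i))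
      where
      a≡0 : a ≡ + 0
      a≡0 = trans a≡4s (cong (+ 4 ℤ.*_) s≡0)
    by-cases (no _) (yes s≡8) = no-deficit-32 x' x (λ i → trans (w≡ i) (ℤP.+-comm (x i) (x' i)))
      (trans a'≡32-a (cong (ℤ._-_ (+ 32)) a≡32))
      (λ i → subst (λ z → + 0 ℤ.≤ Nℤ ℤ.* x i ℤ.+ z ℤ.* + qEx i) a≡32 (g≥0 i))
      where
      a≡32 : a ≡ + 32
      a≡32 = trans a≡4s (cong (+ 4 ℤ.*_) s≡8)
    by-cases (no s≢0) (no s≢8) = no-small-solution (x zero) s
      (ℤP.i<j⇒suc[i]≤j (ℤP.≤∧≢⇒< s≥0 (λ 0≡s → s≢0 (sym 0≡s))))
      (ℤP.i<j⇒i≤pred[j] (ℤP.≤∧≢⇒< s≤8 s≢8)) t≥0 t≤1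

    impossible : ⊥
    impossible = by-cases (s ℤ.≟ + 0) (s ℤ.≟ + 8)

  no-IDP : ¬ IDP (Δvert qEx)
  no-IDP idp = TwoSummands.impossible (xs zero) (xs (suc zero)) (xs∈Δ zero) (xs∈Δ (suc zero))
    (λ i → trans (Σxs≡w i) (cong (ℤ._+_ (xs zero i)) (ℤP.+-identityʳ (xs (suc zero) i))))
    where
    decomposition : Σ (Fin 2 → ZPoint 5) λ xs → (∀ t → P (embed (xs t))) × (∀ i → w i ≡ sumℤ (λ t → xs t i))
    decomposition = idp 2 (ℕ.s≤s ℕ.z≤n) w w∈2Δ
    xs : Fin 2 → ZPoint 5
    xs = proj₁ decomposition
    xs∈Δ : ∀ t → P (embed (xs t))
    xs∈Δ = proj₁ (proj₂ decomposition)
    Σxs≡w : ∀ i → w i ≡ sumℤ (λ t → xs t i)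
    Σxs≡w = proj₂ (proj₂ decomposition)

corollary2p4 : ((n : ℕ) (q : Fin n → ℕ) → WeaklyIncreasing q → Positive q →
    Reflexive (Δvert q) → IDP (Δvert q) → ∀ j → Eqn q j)
    × ((n : ℕ) (q : Fin n → ℕ) → WeaklyIncreasing q → Positive q →
    (∀ j → Eqn q j) → Reflexive (Δvert q))
    × ((∀ j → Eqn qEx j) × ¬ IDP (Δvert qEx))
corollary2p4 =
  (λ n q _ pos reflexive idp j → ReflexiveIDP.eqn q pos reflexive idp j) ,
  (λ n q _ pos eqns → equations⇒reflexive q pos eqns) ,
  (Example.equations , Example.no-IDP)
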